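{- Let $\mathcal B$ be a cartesian bicategory. Then the elementary existential doctrine $\mathcal R(\mathcal B)=\mathrm{Hom}_{\mathcal B}(-,I)\colon\mathrm{Map}(\mathcal B)^{op}\to\mathbf{InfSL}$ has comprehensive diagonals and satisfies the Rule of Unique Choice.
   Context: Composition diagrammatic ($;$). Cartesian bicategory: poset-enriched symmetric monoidal $(\mathcal B,\otimes,I)$ with, for each $X$, $d_X\colon X\to X\otimes X$, $e_X\colon X\to I$ a cocommutative comonoid with right adjoints $d_X^*,e_X^*$ ($\mathrm{id}\le d;d^*$, $d^*;d\le\mathrm{id}$, same for $e$), Frobenius law $(d_X\otimes\mathrm{id});(\mathrm{id}\otimes d_X^*)=d_X^*;d_X$, every $R\colon X\to Y$ satisfying $R;d_Y\le d_X;(R\otimes R)$ and $R;e_Y\le e_X$, and comonoids coherent with $\otimes$. Maps: $f$ with $f;d_Y=d_X;(f\otimes f)$, $f;e_Y=e_X$; they form the cartesian category $\mathrm{Map}(\mathcal B)$ (product $\otimes$, terminal $I$). $\mathcal R(\mathcal B)$ sends $X$ to the meet-semilattice $\mathrm{Hom}_{\mathcal B}(X,I)$ (top $e_X$, meet $R\wedge S=d_X;(R\otimes S)$) and a map $f$ to $U\mapsto f;U$; it is an elementary existential doctrine with $\delta_A=d_A^*;e_A$. For an elementary existential doctrine $P\colon\mathcal C^{op}\to\mathbf{InfSL}$ (with equality predicates $\delta_A\in P(A\times A)$, left adjoints $\exists_\pi$ to $P_\pi=P(\pi)$ along projections, etc.): a comprehension of $\alpha\in P(A)$ is an arrow $c\colon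 X\to A$ with $\top\le P_c(\alpha)$ such that every $h\colon Z\to A$ with $\top\le P_h(\alpha)$ factors as $h=c\circ h'$ for a unique $h'\colon Z\to X$; $P$ has comprehensive diagonals if every $\Delta_A\colon A\to A\times A$ is a comprehension of $\delta_A$. Let $\mathcal A_P$ be the cartesian bicategory with objects of $\mathcal C$, $\mathrm{Hom}(X,Y)=P(X\times Y)$, identity $\delta_X$, composite $f;g=\exists_{\langle\pi_1,\pi_3\rangle}(P_{\langle\pi_1,\pi_2\rangle}f\wedge P_{\langle\pi_2,\pi_3\rangle}g)$, tensor $f\otimes g=P_{\langle\pi_1,\pi_3\rangle}f\wedge P_{\langle\pi_2,\pi_4\rangle}g$, and comonoid structure $P_{\Delta_X\times\mathrm{id}}(\delta_{X\times X})$, $P_{!_X\times\mathrm{id}}(\delta_I)$. $P$ satisfies the Rule of Unique Choice if for every $R\in P(X\times Y)$ which is a map in $\mathcal A_P$ there is $f\colon X\to Y$ in $\mathcal C$ with $\top_{P(X)}\le P_{\langle\mathrm{id}_X,f\rangle}(R)$. -}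

module Defs where

open import Level using (Level; _⊔_; suc)
open import Data.Product using (Σ; Σ-syntax; _×_; _,_)
open import Relation.Binary.PropositionalEquality using (_≡_)


-- Composition is diagrammatic:  f ⨾ g  means "first f, then g".

record CartesianBicategory (o h ℓ : Level) : Set (suc (o ⊔ h ⊔ ℓ)) where
  infixr 9 _⨾_
  infixr 10 _⊗₁_
  infixr 10 _⊗₀_
  infix 4 _≤_
  field
    Obj : Set o
    _⇒_ : Obj → Obj → Set h
    _≤_ : ∀ {X Y} → X ⇒ Y → X ⇒ Y → Set ℓ
    ≤-refl    : ∀ {X Y} {f : X ⇒ Y} → f ≤ f
    ≤-trans   : ∀ {X Y} {f g k : X ⇒ Y} → f ≤ g → g ≤ k → f ≤ k
    ≤-antisym : ∀ {X Y} {f g : X ⇒ Y} → f ≤ g → g ≤ f → f ≡ g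

    id   : ∀ {X} → X ⇒ X
    _⨾_  : ∀ {X Y Z} → X ⇒ Y → Y ⇒ Z → X ⇒ Z
    assoc : ∀ {W X Y Z} {f : W ⇒ X} {g : X ⇒ Y} {k : Y ⇒ Z} →
            (f ⨾ g) ⨾ k ≡ f ⨾ (g ⨾ k)
    idˡ  : ∀ {X Y} {f : X ⇒ Y} → id ⨾ f ≡ f
    idʳ  : ∀ {X Y} {f : X ⇒ Y} → f ⨾ id ≡ f
    ⨾-mono : ∀ {X Y Z} {f f′ : X ⇒ Y} {g g′ : Y ⇒ Z} →
             f ≤ f′ → g ≤ g′ → (f ⨾ g) ≤ (f′ ⨾ g′)

    _⊗₀_ : Obj → Obj → Obj
    I    : Obj
    _⊗₁_ : ∀ {X Y X′ Y′} → X ⇒ Y → X′ ⇒ Y′ → (X ⊗₀ X′) ⇒ (Y ⊗₀ Y′)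
    ⊗-mono : ∀ {X Y X′ Y′} {f g : X ⇒ Y} {f′ g′ : X′ ⇒ Y′} →
             f ≤ g → f′ ≤ g′ → (f ⊗₁ f′) ≤ (g ⊗₁ g′)
    ⊗-id   : ∀ {X Y} → (id {X} ⊗₁ id {Y}) ≡ id
    ⊗-comp : ∀ {X Y Z X′ Y′ Z′} {f : X ⇒ Y} {g : Y ⇒ Z} {f′ : X′ ⇒ Y′} {g′ : Y′ ⇒ Z′} →
             ((f ⨾ g) ⊗₁ (f′ ⨾ g′)) ≡ ((f ⊗₁ f′) ⨾ (g ⊗₁ g′))

    α    : ∀ {X Y Z} → ((X ⊗₀ Y) ⊗₀ Z) ⇒ (X ⊗₀ (Y ⊗₀ Z))
    α⁻¹  : ∀ {X Y Z} → (X ⊗₀ (Y ⊗₀ Z)) ⇒ ((X ⊗₀ Y) ⊗₀ Z)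
    lam  : ∀ {X} → (I ⊗₀ X) ⇒ X
    lam⁻¹ : ∀ {X} → X ⇒ (I ⊗₀ X)
    rho  : ∀ {X} → (X ⊗₀ I) ⇒ X
    rho⁻¹ : ∀ {X} → X ⇒ (X ⊗₀ I)
    σ    : ∀ {X Y} → (X ⊗₀ Y) ⇒ (Y ⊗₀ X)

    α-iso₁   : ∀ {X Y Z} → α {X} {Y} {Z} ⨾ α⁻¹ ≡ id
    α-iso₂   : ∀ {X Y Z} → α⁻¹ {X} {Y} {Z} ⨾ α ≡ id
    lam-iso₁ : ∀ {X} → lam {X} ⨾ lam⁻¹ ≡ id
    lam-iso₂ : ∀ {X} → lam⁻¹ {X} ⨾ lam ≡ id
    rho-iso₁ : ∀ {X} → rho {X} ⨾ rho⁻¹ ≡ id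
    rho-iso₂ : ∀ {X} → rho⁻¹ {X} ⨾ rho ≡ id
    σ-invol  : ∀ {X Y} → σ {X} {Y} ⨾ σ ≡ id

    α-nat   : ∀ {X Y Z X′ Y′ Z′} {f : X ⇒ X′} {g : Y ⇒ Y′} {k : Z ⇒ Z′} →
              ((f ⊗₁ g) ⊗₁ k) ⨾ α ≡ α ⨾ (f ⊗₁ (g ⊗₁ k))
    lam-nat : ∀ {X Y} {f : X ⇒ Y} → (id {I} ⊗₁ f) ⨾ lam ≡ lam ⨾ f
    rho-nat : ∀ {X Y} {f : X ⇒ Y} → (f ⊗₁ id {I}) ⨾ rho ≡ rho ⨾ f
    σ-nat   : ∀ {X Y X′ Y′} {f : X ⇒ X′} {g : Y ⇒ Y′} →
              (f ⊗₁ g) ⨾ σ ≡ σ ⨾ (g ⊗₁ f)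

    pentagon : ∀ {W X Y Z} →
      (α {W} {X} {Y} ⊗₁ id {Z}) ⨾ α {W} {X ⊗₀ Y} {Z} ⨾ (id {W} ⊗₁ α {X} {Y} {Z})
        ≡ α {W ⊗₀ X} {Y} {Z} ⨾ α {W} {X} {Y ⊗₀ Z}
    triangle : ∀ {X Y} → α {X} {I} {Y} ⨾ (id {X} ⊗₁ lam {Y}) ≡ (rho {X} ⊗₁ id {Y})
    hexagon  : ∀ {X Y Z} →
      α {X} {Y} {Z} ⨾ σ {X} {Y ⊗₀ Z} ⨾ α {Y} {Z} {X}
        ≡ (σ {X} {Y} ⊗₁ id {Z}) ⨾ α {Y} {X} {Z} ⨾ (id {Y} ⊗₁ σ {X} {Z})

    d : ∀ X → X ⇒ (X ⊗₀ X)
    e : ∀ X → X ⇒ I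
    coassoc : ∀ {X} → d X ⨾ (d X ⊗₁ id) ⨾ α ≡ d X ⨾ (id ⊗₁ d X)
    counitˡ : ∀ {X} → d X ⨾ (e X ⊗₁ id) ⨾ lam ≡ id
    counitʳ : ∀ {X} → d X ⨾ (id ⊗₁ e X) ⨾ rho ≡ id
    cocomm  : ∀ {X} → d X ⨾ σ ≡ d X

    d* : ∀ X → (X ⊗₀ X) ⇒ X
    e* : ∀ X → I ⇒ X
    d-unit   : ∀ {X} → id ≤ (d X ⨾ d* X)
    d-counit : ∀ {X} → (d* X ⨾ d X) ≤ id
    e-unit   : ∀ {X} → id ≤ (e X ⨾ e* X)
    e-counit : ∀ {X} → (e* X ⨾ e X) ≤ id

    -- Frobenius law (associator made explicit)
    frobenius : ∀ {X} → (d X ⊗₁ id) ⨾ α ⨾ (id ⊗₁ d* X) ≡ d* X ⨾ d X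

    d-lax : ∀ {X Y} (R : X ⇒ Y) → (R ⨾ d Y) ≤ (d X ⨾ (R ⊗₁ R))
    e-lax : ∀ {X Y} (R : X ⇒ Y) → (R ⨾ e Y) ≤ e X

  τ : ∀ {X Y} → ((X ⊗₀ X) ⊗₀ (Y ⊗₀ Y)) ⇒ ((X ⊗₀ Y) ⊗₀ (X ⊗₀ Y))
  τ = α ⨾ (id ⊗₁ α⁻¹) ⨾ (id ⊗₁ (σ ⊗₁ id)) ⨾ (id ⊗₁ α) ⨾ α⁻¹

  field
    d-⊗ : ∀ {X Y} → d (X ⊗₀ Y) ≡ (d X ⊗₁ d Y) ⨾ τ
    e-⊗ : ∀ {X Y} → e (X ⊗₀ Y) ≡ (e X ⊗₁ e Y) ⨾ lam
    d-I : d I ≡ lam⁻¹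
    e-I : e I ≡ id

module Notions {o h ℓ} (B : CartesianBicategory o h ℓ) where
  open CartesianBicategory B

  -- maps of B, i.e. arrows of Map(B)
  IsMap : ∀ {X Y} → X ⇒ Y → Set h
  IsMap {X} {Y} f = (f ⨾ d Y ≡ d X ⨾ (f ⊗₁ f)) × (f ⨾ e Y ≡ e X)

  -- cartesian structure of Map(B): product ⊗, terminal I
  π₁ : ∀ {X Y} → (X ⊗₀ Y) ⇒ X
  π₁ {X} {Y} = (id ⊗₁ e Y) ⨾ rho
  π₂ : ∀ {X Y} → (X ⊗₀ Y) ⇒ Y
  π₂ {X} {Y} = (e X ⊗₁ id) ⨾ lam
  ⟨_,_⟩ : ∀ {Z X Y} → Z ⇒ X → Z ⇒ Y → Z ⇒ (X ⊗₀ Y)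
  ⟨_,_⟩ {Z} f g = d Z ⨾ (f ⊗₁ g)

  -- The doctrine R(B) = Hom_B(-, I) : Map(B)^op → InfSL
  infixr 11 _∧_
  Pred : Obj → Set h
  Pred X = X ⇒ I

  reindex : ∀ {X Y} → X ⇒ Y → Pred Y → Pred X
  reindex f U = f ⨾ U

  ⊤ₚ : ∀ X → Pred X
  ⊤ₚ X = e X

  _∧_ : ∀ {X} → Pred X → Pred X → Pred X
  _∧_ {X} R S = d X ⨾ (R ⊗₁ S) ⨾ rho

  δ : ∀ A → Pred (A ⊗₀ A)
  δ A = d* A ⨾ e A

  IsComprehension : ∀ {X A} → Pred A → X ⇒ A → Set (o ⊔ h ⊔ ℓ)
  IsComprehension {X} {A} a c =
    IsMap c × (⊤ₚ X ≤ reindex c a) ×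
    (∀ {Z} (k : Z ⇒ A) → IsMap k → ⊤ₚ Z ≤ reindex k a →
       Σ[ k′ ∈ Z ⇒ X ] ((IsMap k′ × k ≡ k′ ⨾ c) ×
         (∀ (k″ : Z ⇒ X) → IsMap k″ → k ≡ k″ ⨾ c → k″ ≡ k′)))

  Δ : ∀ A → A ⇒ (A ⊗₀ A)
  Δ A = ⟨ id , id ⟩

  HasComprehensiveDiagonals : Set (o ⊔ h ⊔ ℓ)
  HasComprehensiveDiagonals = ∀ A → IsComprehension (δ A) (Δ A)

  p₁ : ∀ {X Y Z} → ((X ⊗₀ Y) ⊗₀ Z) ⇒ X
  p₁ = π₁ ⨾ π₁
  p₂ : ∀ {X Y Z} → ((X ⊗₀ Y) ⊗₀ Z) ⇒ Y
  p₂ = π₁ ⨾ π₂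
  p₃ : ∀ {X Y Z} → ((X ⊗₀ Y) ⊗₀ Z) ⇒ Z
  p₃ = π₂

  -- The existential quantifier of R(B) along ⟨π₁,π₃⟩ : (X×Y)×Z → X×Z,
  -- characterised as a left adjoint to reindexing.
  record Exists₁₃ : Set (o ⊔ h ⊔ ℓ) where
    field
      ∃₁₃ : ∀ {X Y Z} → Pred ((X ⊗₀ Y) ⊗₀ Z) → Pred (X ⊗₀ Z)
      ∃₁₃-adj₁ : ∀ {X Y Z} (U : Pred ((X ⊗₀ Y) ⊗₀ Z)) (V : Pred (X ⊗₀ Z)) →
                 ∃₁₃ U ≤ V → U ≤ reindex ⟨ p₁ , p₃ ⟩ V
      ∃₁₃-adj₂ : ∀ {X Y Z} (U : Pred ((X ⊗₀ Y) ⊗₀ Z)) (V : Pred (X ⊗₀ Z)) →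
                 U ≤ reindex ⟨ p₁ , p₃ ⟩ V → ∃₁₃ U ≤ V

  -- The cartesian bicategory A_P for P = R(B) (only the structure needed
  -- to say what a map of A_P is).
  module AP (E : Exists₁₃) where
    open Exists₁₃ E
    infixr 9 _⨾ᴬ_
    infixr 10 _⊗ᴬ_

    Rel : Obj → Obj → Set h
    Rel X Y = Pred (X ⊗₀ Y)

    _⨾ᴬ_ : ∀ {X Y Z} → Rel X Y → Rel Y Z → Rel X Z
    f ⨾ᴬ g = ∃₁₃ (reindex ⟨ p₁ , p₂ ⟩ f ∧ reindex ⟨ p₂ , p₃ ⟩ g)

    _⊗ᴬ_ : ∀ {X Y X′ Y′} → Rel X Y → Rel X′ Y′ → Rel (X ⊗₀ X′) (Y ⊗₀ Y′)
    f ⊗ᴬ g = reindex ⟨ π₁ ⨾ π₁ , π₂ ⨾ π₁ ⟩ f ∧ reindex ⟨ π₁ ⨾ π₂ , π₂ ⨾ π₂ ⟩ g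

    dᴬ : ∀ X → Rel X (X ⊗₀ X)
    dᴬ X = reindex (Δ X ⊗₁ id) (δ (X ⊗₀ X))

    eᴬ : ∀ X → Rel X I
    eᴬ X = reindex (e X ⊗₁ id) (δ I)

    IsMapᴬ : ∀ {X Y} → Rel X Y → Set h
    IsMapᴬ {X} {Y} R = (R ⨾ᴬ dᴬ Y ≡ dᴬ X ⨾ᴬ (R ⊗ᴬ R)) × (R ⨾ᴬ eᴬ Y ≡ eᴬ X)

  RuleOfUniqueChoice : Exists₁₃ → Set (o ⊔ h ⊔ ℓ)
  RuleOfUniqueChoice E =
    ∀ {X Y} (R : Pred (X ⊗₀ Y)) → AP.IsMapᴬ E R →
      Σ[ f ∈ X ⇒ Y ] (IsMap f × (⊤ₚ X ≤ reindex ⟨ id , f ⟩ R))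

-- Left adjoints in a cartesian bicategory are maps, so all the structural 1-cells
-- (unitors, associator, symmetry, copying, deleting, projections) live in the
-- cartesian category Map(B), where an arrow into a product is determined by its two
-- projections; this reduces coherence equations between them to equations between
-- projections.
--
-- Diagonals: if a map k satisfies ⊤ ≤ k ⨾ δ then k ⨾ π₁ ≤ k ⨾ d* ≤ k ⨾ π₂, and
-- symmetrically, so k factors as (k ⨾ π₁) ⨾ d.
--
-- Unique choice: by the Frobenius law, g ↦ (g ⊗ id) ⨾ δ is a bijection between
-- 1-cells X ⇒ W and predicates on X ⊗ W.  The 1-cell f corresponding to a relation R
-- that is a map of A_P is total because R is total, and it is single-valued because
-- the graph of d ⨾ (f ⊗ f) lies below that of f ⨾ d, which is exactly what the
-- equation R ⨾ d = d ⨾ (R ⊗ R) of A_P provides.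
module Submission where

open import Defs
open import Level using (_⊔_)
open import Data.Product using (_×_; _,_; proj₁; proj₂; Σ-syntax)
open import Relation.Binary.PropositionalEquality
  using (_≡_; refl; sym; trans; cong; cong₂; subst; module ≡-Reasoning)

module Properties {o h ℓ} (B : CartesianBicategory o h ℓ) where
  open CartesianBicategory B
  open Notions B
  open ≡-Reasoning

  infixr 2 _≤⟨_⟩_ _≈⟨_⟩_
  infix 3 _□

  _≤⟨_⟩_ : ∀ {X Y} (f : X ⇒ Y) {g k : X ⇒ Y} → f ≤ g → g ≤ k → f ≤ k
  f ≤⟨ p ⟩ q = ≤-trans p q

  _≈⟨_⟩_ : ∀ {X Y} (f : X ⇒ Y) {g k : X ⇒ Y} → f ≡ g → g ≤ k → f ≤ k
  f ≈⟨ refl ⟩ q = q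

  _□ : ∀ {X Y} (f : X ⇒ Y) → f ≤ f
  f □ = ≤-refl

  ≡⇒≤ : ∀ {X Y} {f g : X ⇒ Y} → f ≡ g → f ≤ g
  ≡⇒≤ refl = ≤-refl

  ⨾-monoˡ : ∀ {X Y Z} {f f′ : X ⇒ Y} {g : Y ⇒ Z} → f ≤ f′ → f ⨾ g ≤ f′ ⨾ g
  ⨾-monoˡ p = ⨾-mono p ≤-refl

  ⨾-monoʳ : ∀ {X Y Z} {f : X ⇒ Y} {g g′ : Y ⇒ Z} → g ≤ g′ → f ⨾ g ≤ f ⨾ g′
  ⨾-monoʳ p = ⨾-mono ≤-refl p

  ⊗-monoˡ : ∀ {X Y X′ Y′} {f g : X ⇒ Y} {k : X′ ⇒ Y′} → f ≤ g → f ⊗₁ k ≤ g ⊗₁ k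
  ⊗-monoˡ p = ⊗-mono p ≤-refl

  ⊗-monoʳ : ∀ {X Y X′ Y′} {k : X ⇒ Y} {f g : X′ ⇒ Y′} → f ≤ g → k ⊗₁ f ≤ k ⊗₁ g
  ⊗-monoʳ p = ⊗-mono ≤-refl p

  infixr 8 _⟩⨾_

  _⟩⨾_ : ∀ {X Y Z} (f : X ⇒ Y) {g g′ : Y ⇒ Z} → g ≡ g′ → f ⨾ g ≡ f ⨾ g′
  f ⟩⨾ eq = cong (f ⨾_) eq

  pullˡ : ∀ {W X Y Z} {f : W ⇒ X} {g : X ⇒ Y} {k : W ⇒ Y} {r : Y ⇒ Z} →
          f ⨾ g ≡ k → f ⨾ g ⨾ r ≡ k ⨾ r
  pullˡ {r = r} eq = trans (sym assoc) (cong (_⨾ r) eq)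

  pushˡ : ∀ {W X Y Z} {f : W ⇒ X} {g : X ⇒ Y} {k : W ⇒ Y} {r : Y ⇒ Z} →
          k ≡ f ⨾ g → k ⨾ r ≡ f ⨾ g ⨾ r
  pushˡ eq = sym (pullˡ (sym eq))

  pull³ : ∀ {A B C D E} {a : A ⇒ B} {b : B ⇒ C} {c : C ⇒ D} {k : A ⇒ D} {r : D ⇒ E} →
          a ⨾ b ⨾ c ≡ k → a ⨾ b ⨾ c ⨾ r ≡ k ⨾ r
  pull³ {a = a} {r = r} eq = trans (a ⟩⨾ sym assoc) (trans (sym assoc) (cong (_⨾ r) eq))

  cancelˡ : ∀ {W X Y} {f : W ⇒ X} {g : X ⇒ W} {r : W ⇒ Y} → f ⨾ g ≡ id → f ⨾ g ⨾ r ≡ r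
  cancelˡ eq = trans (pullˡ eq) idˡ

  slideˡ : ∀ {A B C D Z} {x : A ⇒ B} {u : B ⇒ C} {u′ : A ⇒ D} {y : D ⇒ C} {r : C ⇒ Z} →
           x ⨾ u ≡ u′ ⨾ y → x ⨾ u ⨾ r ≡ u′ ⨾ y ⨾ r
  slideˡ {r = r} eq = trans (sym assoc) (trans (cong (_⨾ r) eq) assoc)

  ⊗-fuse : ∀ {X Y Z X′ Y′ Z′} {f : X ⇒ Y} {g : Y ⇒ Z} {f′ : X′ ⇒ Y′} {g′ : Y′ ⇒ Z′} →
           (f ⊗₁ f′) ⨾ (g ⊗₁ g′) ≡ (f ⨾ g) ⊗₁ (f′ ⨾ g′)
  ⊗-fuse = sym ⊗-comp

  id⊗-fuse : ∀ {X Y Z W} {f : X ⇒ Y} {g : Y ⇒ Z} → (id {W} ⊗₁ f) ⨾ (id ⊗₁ g) ≡ id ⊗₁ (f ⨾ g)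
  id⊗-fuse = trans ⊗-fuse (cong (_⊗₁ _) idˡ)

  ⊗id-fuse : ∀ {X Y Z W} {f : X ⇒ Y} {g : Y ⇒ Z} → (f ⊗₁ id {W}) ⨾ (g ⊗₁ id) ≡ (f ⨾ g) ⊗₁ id
  ⊗id-fuse = trans ⊗-fuse (cong (_ ⊗₁_) idˡ)

  ⊗-splitˡ : ∀ {X Y X′ Y′} {f : X ⇒ Y} {g : X′ ⇒ Y′} → f ⊗₁ g ≡ (f ⊗₁ id) ⨾ (id ⊗₁ g)
  ⊗-splitˡ = trans (cong₂ _⊗₁_ (sym idʳ) (sym idˡ)) ⊗-comp

  ⊗-splitʳ : ∀ {X Y X′ Y′} {f : X ⇒ Y} {g : X′ ⇒ Y′} → f ⊗₁ g ≡ (id ⊗₁ g) ⨾ (f ⊗₁ id)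
  ⊗-splitʳ = trans (cong₂ _⊗₁_ (sym idˡ) (sym idʳ)) ⊗-comp

  ⊗-slideʳ : ∀ {W W′ A B C D} {a : W ⇒ W′} {f : A ⇒ B} {u : B ⇒ C} {u′ : A ⇒ D} {g : D ⇒ C} →
             f ⨾ u ≡ u′ ⨾ g → (a ⊗₁ f) ⨾ (id ⊗₁ u) ≡ (id ⊗₁ u′) ⨾ (a ⊗₁ g)
  ⊗-slideʳ eq = trans ⊗-fuse (trans (cong₂ _⊗₁_ (trans idʳ (sym idˡ)) eq) ⊗-comp)

  inverse-natural : ∀ {A B A′ B′} {u : A ⇒ B} {v : B ⇒ A} {u′ : A′ ⇒ B′} {v′ : B′ ⇒ A′}
                    {x : A ⇒ A′} {y : B ⇒ B′} → v ⨾ u ≡ id → u′ ⨾ v′ ≡ id →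
                    x ⨾ u′ ≡ u ⨾ y → v ⨾ x ≡ y ⨾ v′
  inverse-natural {u = u} {v} {u′} {v′} {x} {y} vu uv eq = begin
    v ⨾ x                 ≡⟨ v ⟩⨾ trans (sym idʳ) (trans (x ⟩⨾ sym uv) (sym assoc)) ⟩
    v ⨾ (x ⨾ u′) ⨾ v′     ≡⟨ v ⟩⨾ cong (_⨾ v′) eq ⟩
    v ⨾ (u ⨾ y) ⨾ v′      ≡⟨ v ⟩⨾ assoc ⟩
    v ⨾ u ⨾ y ⨾ v′        ≡⟨ cancelˡ vu ⟩
    y ⨾ v′                ∎

  α⁻¹-nat : ∀ {X Y Z X′ Y′ Z′} {f : X ⇒ X′} {g : Y ⇒ Y′} {k : Z ⇒ Z′} →
            (f ⊗₁ (g ⊗₁ k)) ⨾ α⁻¹ ≡ α⁻¹ ⨾ ((f ⊗₁ g) ⊗₁ k)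
  α⁻¹-nat = sym (inverse-natural α-iso₂ α-iso₁ α-nat)

  rho⁻¹-nat : ∀ {X Y} {f : X ⇒ Y} → f ⨾ rho⁻¹ ≡ rho⁻¹ ⨾ (f ⊗₁ id)
  rho⁻¹-nat = sym (inverse-natural rho-iso₂ rho-iso₁ rho-nat)

  -- Left adjoints are maps

  LeftAdjoint : ∀ {X Y} → X ⇒ Y → Set (h ⊔ ℓ)
  LeftAdjoint {X} {Y} f = Σ[ g ∈ Y ⇒ X ] ((id ≤ f ⨾ g) × (g ⨾ f ≤ id))

  rightAdjoint-unique : ∀ {X Y} {f : X ⇒ Y} {g g′ : Y ⇒ X} →
    id ≤ f ⨾ g → g ⨾ f ≤ id → id ≤ f ⨾ g′ → g′ ⨾ f ≤ id → g ≡ g′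
  rightAdjoint-unique {f = f} u c u′ c′ = ≤-antisym (below u c u′ c′) (below u′ c′ u c)
    where
    below : ∀ {g g′} → id ≤ f ⨾ g → g ⨾ f ≤ id → id ≤ f ⨾ g′ → g′ ⨾ f ≤ id → g ≤ g′
    below {g} {g′} _ c u′ _ =
      g ≈⟨ sym idʳ ⟩ g ⨾ id ≤⟨ ⨾-monoʳ u′ ⟩ g ⨾ f ⨾ g′ ≈⟨ sym assoc ⟩ (g ⨾ f) ⨾ g′
        ≤⟨ ⨾-monoˡ c ⟩ id ⨾ g′ ≈⟨ idˡ ⟩ g′ □

  ≤-e : ∀ {X} (P : Pred X) → P ≤ e X
  ≤-e {X} P = P ≈⟨ sym idʳ ⟩ P ⨾ id ≈⟨ P ⟩⨾ sym e-I ⟩ P ⨾ e I ≤⟨ e-lax P ⟩ e X □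

  Total : ∀ {X Y} → X ⇒ Y → Set h
  Total {X} {Y} f = f ⨾ e Y ≡ e X

  e-unique : ∀ {X} {f : X ⇒ I} → Total f → f ≡ e X
  e-unique {f = f} p = trans (sym idʳ) (trans (f ⟩⨾ sym e-I) p)

  ladj⇒map : ∀ {X Y} {f : X ⇒ Y} → LeftAdjoint f → IsMap f
  ladj⇒map {X} {Y} {f} (g , u , c) = ≤-antisym (d-lax f) d-colax , ≤-antisym (e-lax f) e-colax
    where
    d-colax : d X ⨾ (f ⊗₁ f) ≤ f ⨾ d Y
    d-colax = d X ⨾ (f ⊗₁ f) ≈⟨ sym idˡ ⟩ id ⨾ d X ⨾ (f ⊗₁ f) ≤⟨ ⨾-monoˡ u ⟩
      (f ⨾ g) ⨾ d X ⨾ (f ⊗₁ f) ≈⟨ trans assoc (f ⟩⨾ sym assoc) ⟩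
      f ⨾ (g ⨾ d X) ⨾ (f ⊗₁ f) ≤⟨ ⨾-monoʳ (⨾-monoˡ (d-lax g)) ⟩
      f ⨾ (d Y ⨾ (g ⊗₁ g)) ⨾ (f ⊗₁ f) ≈⟨ f ⟩⨾ trans assoc (d Y ⟩⨾ ⊗-fuse) ⟩
      f ⨾ d Y ⨾ ((g ⨾ f) ⊗₁ (g ⨾ f)) ≤⟨ ⨾-monoʳ (⨾-monoʳ (⊗-mono c c)) ⟩
      f ⨾ d Y ⨾ (id ⊗₁ id) ≈⟨ f ⟩⨾ trans (d Y ⟩⨾ ⊗-id) idʳ ⟩
      f ⨾ d Y □
    e-colax : e X ≤ f ⨾ e Y
    e-colax = e X ≈⟨ sym idˡ ⟩ id ⨾ e X ≤⟨ ⨾-monoˡ u ⟩ (f ⨾ g) ⨾ e X ≈⟨ assoc ⟩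
      f ⨾ g ⨾ e X ≤⟨ ⨾-monoʳ (e-lax g) ⟩ f ⨾ e Y □

  ladj⇒d-natural : ∀ {X Y} {f : X ⇒ Y} → LeftAdjoint f → f ⨾ d Y ≡ d X ⨾ (f ⊗₁ f)
  ladj⇒d-natural l = proj₁ (ladj⇒map l)

  ladj⇒total : ∀ {X Y} {f : X ⇒ Y} → LeftAdjoint f → Total f
  ladj⇒total l = proj₂ (ladj⇒map l)

  map-⨾ : ∀ {X Y Z} {f : X ⇒ Y} {g : Y ⇒ Z} → IsMap f → IsMap g → IsMap (f ⨾ g)
  map-⨾ {X} {Y} {Z} {f} {g} (fd , fe) (gd , ge) = d-natural , trans assoc (trans (f ⟩⨾ ge) fe)
    where
    d-natural : (f ⨾ g) ⨾ d Z ≡ d X ⨾ ((f ⨾ g) ⊗₁ (f ⨾ g))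
    d-natural = begin
      (f ⨾ g) ⨾ d Z                  ≡⟨ trans assoc (f ⟩⨾ gd) ⟩
      f ⨾ d Y ⨾ (g ⊗₁ g)             ≡⟨ pullˡ fd ⟩
      (d X ⨾ (f ⊗₁ f)) ⨾ (g ⊗₁ g)    ≡⟨ trans assoc (d X ⟩⨾ ⊗-fuse) ⟩
      d X ⨾ ((f ⨾ g) ⊗₁ (f ⨾ g))     ∎

  ladj-id : ∀ {X} → LeftAdjoint (id {X})
  ladj-id = id , ≡⇒≤ (sym idˡ) , ≡⇒≤ idˡ

  ladj-⨾ : ∀ {X Y Z} {f : X ⇒ Y} {f′ : Y ⇒ Z} → LeftAdjoint f → LeftAdjoint f′ → LeftAdjoint (f ⨾ f′)
  ladj-⨾ {f = f} {f′} (g , u , c) (g′ , u′ , c′) = g′ ⨾ g , unit , counit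
    where
    unit : id ≤ (f ⨾ f′) ⨾ g′ ⨾ g
    unit = id ≤⟨ u ⟩ f ⨾ g ≈⟨ f ⟩⨾ sym idˡ ⟩ f ⨾ id ⨾ g ≤⟨ ⨾-monoʳ (⨾-monoˡ u′) ⟩
      f ⨾ (f′ ⨾ g′) ⨾ g ≈⟨ trans (f ⟩⨾ assoc) (sym assoc) ⟩ (f ⨾ f′) ⨾ g′ ⨾ g □
    counit : (g′ ⨾ g) ⨾ f ⨾ f′ ≤ id
    counit = (g′ ⨾ g) ⨾ f ⨾ f′ ≈⟨ trans assoc (g′ ⟩⨾ sym assoc) ⟩ g′ ⨾ (g ⨾ f) ⨾ f′
      ≤⟨ ⨾-monoʳ (⨾-monoˡ c) ⟩ g′ ⨾ id ⨾ f′ ≈⟨ g′ ⟩⨾ idˡ ⟩ g′ ⨾ f′ ≤⟨ c′ ⟩ id □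

  ladj-⊗ : ∀ {X Y X′ Y′} {f : X ⇒ Y} {f′ : X′ ⇒ Y′} → LeftAdjoint f → LeftAdjoint f′ → LeftAdjoint (f ⊗₁ f′)
  ladj-⊗ {f = f} {f′} (g , u , c) (g′ , u′ , c′) = g ⊗₁ g′ ,
    (id ≈⟨ sym ⊗-id ⟩ id ⊗₁ id ≤⟨ ⊗-mono u u′ ⟩ (f ⨾ g) ⊗₁ (f′ ⨾ g′) ≈⟨ ⊗-comp ⟩ _ □) ,
    (_ ≈⟨ ⊗-fuse ⟩ (g ⨾ f) ⊗₁ (g′ ⨾ f′) ≤⟨ ⊗-mono c c′ ⟩ id ⊗₁ id ≈⟨ ⊗-id ⟩ id □)

  ladj-iso : ∀ {X Y} {u : X ⇒ Y} {v : Y ⇒ X} → u ⨾ v ≡ id → v ⨾ u ≡ id → LeftAdjoint u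
  ladj-iso {v = v} p q = v , ≡⇒≤ (sym p) , ≡⇒≤ q

  ladj-d : ∀ {X} → LeftAdjoint (d X)
  ladj-d = _ , d-unit , d-counit

  ladj-e : ∀ {X} → LeftAdjoint (e X)
  ladj-e = _ , e-unit , e-counit

  ladj-α : ∀ {X Y Z} → LeftAdjoint (α {X} {Y} {Z})
  ladj-α = ladj-iso α-iso₁ α-iso₂

  ladj-α⁻¹ : ∀ {X Y Z} → LeftAdjoint (α⁻¹ {X} {Y} {Z})
  ladj-α⁻¹ = ladj-iso α-iso₂ α-iso₁

  ladj-lam : ∀ {X} → LeftAdjoint (lam {X})
  ladj-lam = ladj-iso lam-iso₁ lam-iso₂

  ladj-lam⁻¹ : ∀ {X} → LeftAdjoint (lam⁻¹ {X})
  ladj-lam⁻¹ = ladj-iso lam-iso₂ lam-iso₁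

  ladj-rho : ∀ {X} → LeftAdjoint (rho {X})
  ladj-rho = ladj-iso rho-iso₁ rho-iso₂

  ladj-rho⁻¹ : ∀ {X} → LeftAdjoint (rho⁻¹ {X})
  ladj-rho⁻¹ = ladj-iso rho-iso₂ rho-iso₁

  ladj-σ : ∀ {X Y} → LeftAdjoint (σ {X} {Y})
  ladj-σ = ladj-iso σ-invol σ-invol

  ladj-π₁ : ∀ {X Y} → LeftAdjoint (π₁ {X} {Y})
  ladj-π₁ = ladj-⨾ (ladj-⊗ ladj-id ladj-e) ladj-rho

  ladj-π₂ : ∀ {X Y} → LeftAdjoint (π₂ {X} {Y})
  ladj-π₂ = ladj-⨾ (ladj-⊗ ladj-e ladj-id) ladj-lam

  -- Projections and the cartesian structure of Map(B)

  counitʳ-⊗ : ∀ {X Y} {f : X ⇒ Y} → d X ⨾ (f ⊗₁ e X) ⨾ rho ≡ f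
  counitʳ-⊗ {X} {f = f} = begin
    d X ⨾ (f ⊗₁ e X) ⨾ rho                   ≡⟨ d X ⟩⨾ cong (_⨾ rho) ⊗-splitʳ ⟩
    d X ⨾ ((id ⊗₁ e X) ⨾ (f ⊗₁ id)) ⨾ rho    ≡⟨ d X ⟩⨾ trans assoc (_ ⟩⨾ rho-nat) ⟩
    d X ⨾ (id ⊗₁ e X) ⨾ rho ⨾ f              ≡⟨ pull³ counitʳ ⟩
    id ⨾ f                                   ≡⟨ idˡ ⟩
    f                                        ∎

  counitˡ-⊗ : ∀ {X Y} {f : X ⇒ Y} → d X ⨾ (e X ⊗₁ f) ⨾ lam ≡ f
  counitˡ-⊗ {X} {f = f} = begin
    d X ⨾ (e X ⊗₁ f) ⨾ lam                   ≡⟨ d X ⟩⨾ cong (_⨾ lam) ⊗-splitˡ ⟩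
    d X ⨾ ((e X ⊗₁ id) ⨾ (id ⊗₁ f)) ⨾ lam    ≡⟨ d X ⟩⨾ trans assoc (_ ⟩⨾ lam-nat) ⟩
    d X ⨾ (e X ⊗₁ id) ⨾ lam ⨾ f              ≡⟨ pull³ counitˡ ⟩
    id ⨾ f                                   ≡⟨ idˡ ⟩
    f                                        ∎

  π₁-natural : ∀ {X Y X′ Y′} {f : X ⇒ Y} {g : X′ ⇒ Y′} → Total g → (f ⊗₁ g) ⨾ π₁ ≡ π₁ ⨾ f
  π₁-natural {f = f} {g} p = begin
    (f ⊗₁ g) ⨾ (id ⊗₁ e _) ⨾ rho       ≡⟨ pullˡ (trans ⊗-fuse (cong₂ _⊗₁_ idʳ p)) ⟩
    (f ⊗₁ e _) ⨾ rho                   ≡⟨ cong (_⨾ rho) ⊗-splitʳ ⟩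
    ((id ⊗₁ e _) ⨾ (f ⊗₁ id)) ⨾ rho    ≡⟨ trans assoc (_ ⟩⨾ rho-nat) ⟩
    (id ⊗₁ e _) ⨾ rho ⨾ f              ≡⟨ sym assoc ⟩
    π₁ ⨾ f                             ∎

  π₂-natural : ∀ {X Y X′ Y′} {f : X ⇒ Y} {g : X′ ⇒ Y′} → Total f → (f ⊗₁ g) ⨾ π₂ ≡ π₂ ⨾ g
  π₂-natural {f = f} {g} p = begin
    (f ⊗₁ g) ⨾ (e _ ⊗₁ id) ⨾ lam       ≡⟨ pullˡ (trans ⊗-fuse (cong₂ _⊗₁_ p idʳ)) ⟩
    (e _ ⊗₁ g) ⨾ lam                   ≡⟨ cong (_⨾ lam) ⊗-splitˡ ⟩
    ((e _ ⊗₁ id) ⨾ (id ⊗₁ g)) ⨾ lam    ≡⟨ trans assoc (_ ⟩⨾ lam-nat) ⟩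
    (e _ ⊗₁ id) ⨾ lam ⨾ g              ≡⟨ sym assoc ⟩
    π₂ ⨾ g                             ∎

  pair⨾π₁ : ∀ {Z X Y} {f : Z ⇒ X} {g : Z ⇒ Y} → Total g → d Z ⨾ (f ⊗₁ g) ⨾ π₁ ≡ f
  pair⨾π₁ {Z} p = trans (d Z ⟩⨾ pullˡ (trans ⊗-fuse (cong₂ _⊗₁_ idʳ p))) counitʳ-⊗

  π₁-total : ∀ {X Y} → Total (π₁ {X} {Y})
  π₁-total = ladj⇒total ladj-π₁

  π₂-total : ∀ {X Y} → Total (π₂ {X} {Y})
  π₂-total = ladj⇒total ladj-π₂

  σ-I : σ {I} {I} ≡ id
  σ-I = begin
    σ                    ≡⟨ sym idʳ ⟩
    σ ⨾ id               ≡⟨ σ ⟩⨾ sym lam-iso₁ ⟩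
    σ ⨾ lam ⨾ lam⁻¹      ≡⟨ pullˡ (trans (e-unique (ladj⇒total (ladj-⨾ ladj-σ ladj-lam)))
                                         (sym (e-unique (ladj⇒total ladj-lam)))) ⟩
    lam ⨾ lam⁻¹          ≡⟨ lam-iso₁ ⟩
    id                   ∎

  rho≡lam : rho {I} ≡ lam {I}
  rho≡lam = trans (e-unique (ladj⇒total ladj-rho)) (sym (e-unique (ladj⇒total ladj-lam)))

  rho≡π₁ : ∀ {X} → rho {X} ≡ π₁ {X} {I}
  rho≡π₁ = sym (trans (cong (λ z → (id ⊗₁ z) ⨾ rho) e-I) (trans (cong (_⨾ rho) ⊗-id) idˡ))

  lam≡π₂ : ∀ {X} → lam {X} ≡ π₂ {I} {X}
  lam≡π₂ = sym (trans (cong (λ z → (z ⊗₁ id) ⨾ lam) e-I) (trans (cong (_⨾ lam) ⊗-id) idˡ))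

  interchange : ∀ {A B C D} → ((A ⊗₀ B) ⊗₀ (C ⊗₀ D)) ⇒ ((A ⊗₀ C) ⊗₀ (B ⊗₀ D))
  interchange = α ⨾ (id ⊗₁ α⁻¹) ⨾ (id ⊗₁ (σ ⊗₁ id)) ⨾ (id ⊗₁ α) ⨾ α⁻¹

  interchange-natural : ∀ {A B C D A′ B′ C′ D′} {a : A ⇒ A′} {b : B ⇒ B′} {c : C ⇒ C′} {k : D ⇒ D′} →
                        ((a ⊗₁ b) ⊗₁ (c ⊗₁ k)) ⨾ interchange ≡ interchange ⨾ ((a ⊗₁ c) ⊗₁ (b ⊗₁ k))
  interchange-natural {a = a} {b} {c} {k} = begin
    ((a ⊗₁ b) ⊗₁ (c ⊗₁ k)) ⨾ α ⨾ _
      ≡⟨ slideˡ α-nat ⟩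
    α ⨾ (a ⊗₁ (b ⊗₁ (c ⊗₁ k))) ⨾ (id ⊗₁ α⁻¹) ⨾ _
      ≡⟨ α ⟩⨾ slideˡ (⊗-slideʳ α⁻¹-nat) ⟩
    α ⨾ (id ⊗₁ α⁻¹) ⨾ (a ⊗₁ ((b ⊗₁ c) ⊗₁ k)) ⨾ (id ⊗₁ (σ ⊗₁ id)) ⨾ _
      ≡⟨ α ⟩⨾ _ ⟩⨾ slideˡ (⊗-slideʳ (trans ⊗-fuse (trans (cong₂ _⊗₁_ σ-nat (trans idʳ (sym idˡ))) ⊗-comp))) ⟩
    α ⨾ (id ⊗₁ α⁻¹) ⨾ (id ⊗₁ (σ ⊗₁ id)) ⨾ (a ⊗₁ ((c ⊗₁ b) ⊗₁ k)) ⨾ (id ⊗₁ α) ⨾ α⁻¹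
      ≡⟨ α ⟩⨾ _ ⟩⨾ _ ⟩⨾ slideˡ (⊗-slideʳ α-nat) ⟩
    α ⨾ (id ⊗₁ α⁻¹) ⨾ (id ⊗₁ (σ ⊗₁ id)) ⨾ (id ⊗₁ α) ⨾ (a ⊗₁ (c ⊗₁ (b ⊗₁ k))) ⨾ α⁻¹
      ≡⟨ α ⟩⨾ _ ⟩⨾ _ ⟩⨾ _ ⟩⨾ α⁻¹-nat ⟩
    α ⨾ (id ⊗₁ α⁻¹) ⨾ (id ⊗₁ (σ ⊗₁ id)) ⨾ (id ⊗₁ α) ⨾ α⁻¹ ⨾ ((a ⊗₁ c) ⊗₁ (b ⊗₁ k))
      ≡⟨ trans (α ⟩⨾ _ ⟩⨾ _ ⟩⨾ sym assoc) (trans (α ⟩⨾ _ ⟩⨾ sym assoc) (trans (α ⟩⨾ sym assoc) (sym assoc))) ⟩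
    interchange ⨾ ((a ⊗₁ c) ⊗₁ (b ⊗₁ k))
      ∎

  interchange-I : ∀ {X Y} → interchange {X} {I} {I} {Y} ≡ id
  interchange-I = begin
    α ⨾ (id ⊗₁ α⁻¹) ⨾ (id ⊗₁ (σ ⊗₁ id)) ⨾ (id ⊗₁ α) ⨾ α⁻¹
      ≡⟨ α ⟩⨾ _ ⟩⨾ cong (_⨾ ((id ⊗₁ α) ⨾ α⁻¹)) (trans (cong (id ⊗₁_) (trans (cong (_⊗₁ id) σ-I) ⊗-id)) ⊗-id) ⟩
    α ⨾ (id ⊗₁ α⁻¹) ⨾ id ⨾ (id ⊗₁ α) ⨾ α⁻¹
      ≡⟨ α ⟩⨾ _ ⟩⨾ idˡ ⟩
    α ⨾ (id ⊗₁ α⁻¹) ⨾ (id ⊗₁ α) ⨾ α⁻¹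
      ≡⟨ α ⟩⨾ pullˡ (trans id⊗-fuse (trans (cong (id ⊗₁_) α-iso₂) ⊗-id)) ⟩
    α ⨾ id ⨾ α⁻¹
      ≡⟨ trans (α ⟩⨾ idˡ) α-iso₁ ⟩
    id
      ∎

  pairing-η : ∀ {X Y} → d (X ⊗₀ Y) ⨾ (π₁ ⊗₁ π₂) ≡ id
  pairing-η {X} {Y} = begin
    d (X ⊗₀ Y) ⨾ (π₁ ⊗₁ π₂)
      ≡⟨ cong₂ _⨾_ d-⊗ ⊗-comp ⟩
    ((d X ⊗₁ d Y) ⨾ interchange) ⨾ ((id ⊗₁ e Y) ⊗₁ (e X ⊗₁ id)) ⨾ (rho ⊗₁ lam)
      ≡⟨ trans assoc (_ ⟩⨾ pullˡ (sym interchange-natural)) ⟩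
    (d X ⊗₁ d Y) ⨾ (((id ⊗₁ e X) ⊗₁ (e Y ⊗₁ id)) ⨾ interchange) ⨾ (rho ⊗₁ lam)
      ≡⟨ _ ⟩⨾ trans assoc (_ ⟩⨾ trans (cong (_⨾ _) interchange-I) idˡ) ⟩
    (d X ⊗₁ d Y) ⨾ ((id ⊗₁ e X) ⊗₁ (e Y ⊗₁ id)) ⨾ (rho ⊗₁ lam)
      ≡⟨ trans (_ ⟩⨾ ⊗-fuse) ⊗-fuse ⟩
    (d X ⨾ (id ⊗₁ e X) ⨾ rho) ⊗₁ (d Y ⨾ (e Y ⊗₁ id) ⨾ lam)
      ≡⟨ trans (cong₂ _⊗₁_ counitʳ counitˡ) ⊗-id ⟩
    id
      ∎

  pairing-π : ∀ {A B A′ B′} {a : A ⇒ A′} {b : B ⇒ B′} → d (A ⊗₀ B) ⨾ ((π₁ ⨾ a) ⊗₁ (π₂ ⨾ b)) ≡ a ⊗₁ b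
  pairing-π = trans (_ ⟩⨾ ⊗-comp) (trans (pullˡ pairing-η) idˡ)

  map-ext : ∀ {Z X Y} {f g : Z ⇒ (X ⊗₀ Y)} → IsMap f → IsMap g →
            f ⨾ π₁ ≡ g ⨾ π₁ → f ⨾ π₂ ≡ g ⨾ π₂ → f ≡ g
  map-ext {Z} {f = f} {g} mf mg p q = begin
    f                                  ≡⟨ sym (trans (f ⟩⨾ pairing-η) idʳ) ⟩
    f ⨾ d _ ⨾ (π₁ ⊗₁ π₂)               ≡⟨ pullˡ (proj₁ mf) ⟩
    (d Z ⨾ (f ⊗₁ f)) ⨾ (π₁ ⊗₁ π₂)      ≡⟨ trans assoc (d Z ⟩⨾ trans ⊗-fuse (cong₂ _⊗₁_ p q)) ⟩
    d Z ⨾ ((g ⨾ π₁) ⊗₁ (g ⨾ π₂))       ≡⟨ sym (trans assoc (d Z ⟩⨾ ⊗-fuse)) ⟩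
    (d Z ⨾ (g ⊗₁ g)) ⨾ (π₁ ⊗₁ π₂)      ≡⟨ sym (pullˡ (proj₁ mg)) ⟩
    g ⨾ d _ ⨾ (π₁ ⊗₁ π₂)               ≡⟨ trans (g ⟩⨾ pairing-η) idʳ ⟩
    g                                  ∎

  σ⨾π₁ : ∀ {X Y} → σ {X} {Y} ⨾ π₁ ≡ π₂
  σ⨾π₁ = begin
    σ ⨾ π₁                               ≡⟨ sym idˡ ⟩
    id ⨾ σ ⨾ π₁                          ≡⟨ cong (_⨾ (σ ⨾ π₁)) (sym pairing-η) ⟩
    (d _ ⨾ (π₁ ⊗₁ π₂)) ⨾ σ ⨾ π₁          ≡⟨ trans assoc (d _ ⟩⨾ slideˡ σ-nat) ⟩
    d _ ⨾ σ ⨾ (π₂ ⊗₁ π₁) ⨾ π₁            ≡⟨ pullˡ cocomm ⟩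
    d _ ⨾ (π₂ ⊗₁ π₁) ⨾ π₁                ≡⟨ pair⨾π₁ π₁-total ⟩
    π₂                                   ∎

  σ⨾π₂ : ∀ {X Y} → σ {X} {Y} ⨾ π₂ ≡ π₁
  σ⨾π₂ = trans (σ ⟩⨾ sym σ⨾π₁) (cancelˡ σ-invol)

  α⨾π₁ : ∀ {X Y Z} → α {X} {Y} {Z} ⨾ π₁ ≡ π₁ ⨾ π₁
  α⨾π₁ {X} {Y} {Z} = begin
    α ⨾ (id ⊗₁ e (Y ⊗₀ Z)) ⨾ rho               ≡⟨ α ⟩⨾ cong (λ z → (id ⊗₁ z) ⨾ rho) e-⊗ ⟩
    α ⨾ (id ⊗₁ ((e Y ⊗₁ e Z) ⨾ lam)) ⨾ rho     ≡⟨ α ⟩⨾ pushˡ (sym id⊗-fuse) ⟩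
    α ⨾ (id ⊗₁ (e Y ⊗₁ e Z)) ⨾ (id ⊗₁ lam) ⨾ rho  ≡⟨ pullˡ (sym α-nat) ⟩
    (((id ⊗₁ e Y) ⊗₁ e Z) ⨾ α) ⨾ (id ⊗₁ lam) ⨾ rho ≡⟨ trans assoc (_ ⟩⨾ pullˡ triangle) ⟩
    ((id ⊗₁ e Y) ⊗₁ e Z) ⨾ (rho ⊗₁ id) ⨾ rho   ≡⟨ pullˡ (trans ⊗-fuse (cong (π₁ ⊗₁_) idʳ)) ⟩
    (π₁ ⊗₁ e Z) ⨾ rho                          ≡⟨ trans (cong (_⨾ rho) ⊗-splitˡ) assoc ⟩
    (π₁ ⊗₁ id) ⨾ π₁                            ≡⟨ π₁-natural idˡ ⟩
    π₁ ⨾ π₁                                    ∎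

  α⨾π₂⨾π₁ : ∀ {X Y Z} → α {X} {Y} {Z} ⨾ π₂ ⨾ π₁ ≡ π₁ ⨾ π₂
  α⨾π₂⨾π₁ = begin
    α ⨾ π₂ ⨾ π₁                          ≡⟨ α ⟩⨾ cong (_⨾ π₁) (sym σ⨾π₁) ⟩
    α ⨾ (σ ⨾ π₁) ⨾ π₁                    ≡⟨ α ⟩⨾ trans assoc (σ ⟩⨾ sym α⨾π₁) ⟩
    α ⨾ σ ⨾ α ⨾ π₁                       ≡⟨ pull³ hexagon ⟩
    ((σ ⊗₁ id) ⨾ α ⨾ (id ⊗₁ σ)) ⨾ π₁     ≡⟨ trans assoc (_ ⟩⨾ trans assoc (α ⟩⨾ π₁-natural (ladj⇒total ladj-σ))) ⟩
    (σ ⊗₁ id) ⨾ α ⨾ π₁ ⨾ id              ≡⟨ _ ⟩⨾ trans (α ⟩⨾ idʳ) α⨾π₁ ⟩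
    (σ ⊗₁ id) ⨾ π₁ ⨾ π₁                  ≡⟨ pullˡ (π₁-natural idˡ) ⟩
    (π₁ ⨾ σ) ⨾ π₁                        ≡⟨ trans assoc (π₁ ⟩⨾ σ⨾π₁) ⟩
    π₁ ⨾ π₂                              ∎

  α⨾π₂⨾π₂ : ∀ {X Y Z} → α {X} {Y} {Z} ⨾ π₂ ⨾ π₂ ≡ π₂
  α⨾π₂⨾π₂ {X} {Y} {Z} = begin
    α ⨾ ((e X ⊗₁ id) ⨾ lam) ⨾ ((e Y ⊗₁ id) ⨾ lam)
      ≡⟨ α ⟩⨾ trans assoc (_ ⟩⨾ pullˡ (sym lam-nat)) ⟩
    α ⨾ (e X ⊗₁ id) ⨾ ((id ⊗₁ (e Y ⊗₁ id)) ⨾ lam) ⨾ lam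
      ≡⟨ α ⟩⨾ trans (_ ⟩⨾ assoc) (sym assoc) ⟩
    α ⨾ ((e X ⊗₁ id) ⨾ (id ⊗₁ (e Y ⊗₁ id))) ⨾ lam ⨾ lam
      ≡⟨ α ⟩⨾ cong₂ _⨾_ (trans ⊗-fuse (cong₂ _⊗₁_ idʳ idˡ)) (sym lam-nat) ⟩
    α ⨾ (e X ⊗₁ (e Y ⊗₁ id)) ⨾ (id ⊗₁ lam) ⨾ lam
      ≡⟨ pullˡ (sym α-nat) ⟩
    (((e X ⊗₁ e Y) ⊗₁ id) ⨾ α) ⨾ (id ⊗₁ lam) ⨾ lam
      ≡⟨ trans assoc (_ ⟩⨾ pullˡ triangle) ⟩
    ((e X ⊗₁ e Y) ⊗₁ id) ⨾ (rho ⊗₁ id) ⨾ lam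
      ≡⟨ pullˡ ⊗id-fuse ⟩
    (((e X ⊗₁ e Y) ⨾ rho) ⊗₁ id) ⨾ lam
      ≡⟨ cong (λ z → (((e X ⊗₁ e Y) ⨾ z) ⊗₁ id) ⨾ lam) rho≡lam ⟩
    (((e X ⊗₁ e Y) ⨾ lam) ⊗₁ id) ⨾ lam
      ≡⟨ cong (λ z → (z ⊗₁ id) ⨾ lam) (sym e-⊗) ⟩
    π₂
      ∎

  α⨾π₂ : ∀ {X Y Z} → α {X} {Y} {Z} ⨾ π₂ ≡ π₂ ⊗₁ id
  α⨾π₂ = map-ext (ladj⇒map (ladj-⨾ ladj-α ladj-π₂)) (ladj⇒map (ladj-⊗ ladj-π₂ ladj-id))
    (trans assoc (trans α⨾π₂⨾π₁ (sym (π₁-natural idˡ))))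
    (trans assoc (trans α⨾π₂⨾π₂ (sym (trans (π₂-natural π₂-total) idʳ))))

  α⨾id⊗π₂ : ∀ {X Y Z} → α {X} {Y} {Z} ⨾ (id ⊗₁ π₂) ≡ π₁ ⊗₁ id
  α⨾id⊗π₂ = map-ext (ladj⇒map (ladj-⨾ ladj-α (ladj-⊗ ladj-id ladj-π₂))) (ladj⇒map (ladj-⊗ ladj-π₁ ladj-id))
    (trans assoc (trans (_ ⟩⨾ trans (π₁-natural π₂-total) idʳ) (trans α⨾π₁ (sym (π₁-natural idˡ)))))
    (trans assoc (trans (_ ⟩⨾ π₂-natural idˡ) (trans α⨾π₂⨾π₂ (sym (trans (π₂-natural π₁-total) idʳ)))))

  α⁻¹⨾π₁⨾π₁ : ∀ {X Y Z} → α⁻¹ {X} {Y} {Z} ⨾ π₁ ⨾ π₁ ≡ π₁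
  α⁻¹⨾π₁⨾π₁ = trans (_ ⟩⨾ sym α⨾π₁) (cancelˡ α-iso₂)

  α⁻¹⨾π₁⨾π₂ : ∀ {X Y Z} → α⁻¹ {X} {Y} {Z} ⨾ π₁ ⨾ π₂ ≡ π₂ ⨾ π₁
  α⁻¹⨾π₁⨾π₂ = trans (_ ⟩⨾ sym α⨾π₂⨾π₁) (cancelˡ α-iso₂)

  α⁻¹⨾π₂ : ∀ {X Y Z} → α⁻¹ {X} {Y} {Z} ⨾ π₂ ≡ π₂ ⨾ π₂
  α⁻¹⨾π₂ = trans (_ ⟩⨾ sym α⨾π₂⨾π₂) (cancelˡ α-iso₂)

  α⁻¹⨾π₁ : ∀ {X Y Z} → α⁻¹ {X} {Y} {Z} ⨾ π₁ ≡ id ⊗₁ π₁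
  α⁻¹⨾π₁ = map-ext (ladj⇒map (ladj-⨾ ladj-α⁻¹ ladj-π₁)) (ladj⇒map (ladj-⊗ ladj-id ladj-π₁))
    (trans assoc (trans α⁻¹⨾π₁⨾π₁ (sym (trans (π₁-natural π₁-total) idʳ))))
    (trans assoc (trans α⁻¹⨾π₁⨾π₂ (sym (π₂-natural idˡ))))

  α⁻¹⨾π₂⊗id : ∀ {X Y Z} → α⁻¹ {X} {Y} {Z} ⨾ (π₂ ⊗₁ id) ≡ π₂
  α⁻¹⨾π₂⊗id = map-ext (ladj⇒map (ladj-⨾ ladj-α⁻¹ (ladj-⊗ ladj-π₂ ladj-id))) (ladj⇒map ladj-π₂)
    (trans assoc (trans (_ ⟩⨾ π₁-natural idˡ) (trans (sym assoc) (trans (cong (_⨾ π₂) α⁻¹⨾π₁) (π₂-natural idˡ)))))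
    (trans assoc (trans (_ ⟩⨾ trans (π₂-natural π₂-total) idʳ) α⁻¹⨾π₂))

  d⨾π₁⊗id : ∀ {V W} → d (V ⊗₀ W) ⨾ (π₁ ⊗₁ id) ≡ (d V ⊗₁ id) ⨾ α
  d⨾π₁⊗id = map-ext (ladj⇒map (ladj-⨾ ladj-d (ladj-⊗ ladj-π₁ ladj-id))) (ladj⇒map (ladj-⨾ (ladj-⊗ ladj-d ladj-id) ladj-α))
    (trans assoc (trans (_ ⟩⨾ π₁-natural idˡ) (trans (pullˡ counitʳ) (trans idˡ (sym
       (trans assoc (trans (_ ⟩⨾ α⨾π₁) (trans (pullˡ (π₁-natural idˡ)) (trans assoc (trans (_ ⟩⨾ counitʳ) idʳ))))))))))
    (trans assoc (trans (_ ⟩⨾ trans (π₂-natural π₁-total) idʳ) (trans counitˡ (sym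
       (trans assoc (trans (_ ⟩⨾ α⨾π₂) (trans ⊗-fuse (trans (cong₂ _⊗₁_ counitˡ idˡ) ⊗-id))))))))

  d⨾id⊗π₂ : ∀ {X V} → d (X ⊗₀ V) ⨾ (id ⊗₁ π₂) ≡ (id ⊗₁ d V) ⨾ α⁻¹
  d⨾id⊗π₂ = map-ext (ladj⇒map (ladj-⨾ ladj-d (ladj-⊗ ladj-id ladj-π₂))) (ladj⇒map (ladj-⨾ (ladj-⊗ ladj-id ladj-d) ladj-α⁻¹))
    (trans assoc (trans (_ ⟩⨾ trans (π₁-natural π₂-total) idʳ) (trans counitʳ (sym
       (trans assoc (trans (_ ⟩⨾ α⁻¹⨾π₁) (trans id⊗-fuse (trans (cong (id ⊗₁_) counitʳ) ⊗-id))))))))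
    (trans assoc (trans (_ ⟩⨾ π₂-natural idˡ) (trans (pullˡ counitˡ) (trans idˡ (sym
       (trans assoc (trans (_ ⟩⨾ α⁻¹⨾π₂) (trans (pullˡ (π₂-natural idˡ)) (trans assoc (trans (_ ⟩⨾ counitˡ) idʳ))))))))))

  α⁻¹-via-σ : ∀ {X Y Z} → (id ⊗₁ σ) ⨾ σ ⨾ α ⨾ σ ⨾ (σ ⊗₁ id) ≡ α⁻¹ {X} {Y} {Z}
  α⁻¹-via-σ = map-ext (ladj⇒map ladj-lhs) (ladj⇒map ladj-α⁻¹) first second
    where
    ladj-lhs = ladj-⨾ (ladj-⊗ ladj-id ladj-σ) (ladj-⨾ ladj-σ (ladj-⨾ ladj-α (ladj-⨾ ladj-σ (ladj-⊗ ladj-σ ladj-id))))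
    first = begin
      ((id ⊗₁ σ) ⨾ σ ⨾ α ⨾ σ ⨾ (σ ⊗₁ id)) ⨾ π₁
        ≡⟨ trans assoc (_ ⟩⨾ trans assoc (σ ⟩⨾ trans assoc (α ⟩⨾ trans assoc (σ ⟩⨾ π₁-natural idˡ)))) ⟩
      (id ⊗₁ σ) ⨾ σ ⨾ α ⨾ σ ⨾ π₁ ⨾ σ   ≡⟨ _ ⟩⨾ σ ⟩⨾ α ⟩⨾ pullˡ σ⨾π₁ ⟩
      (id ⊗₁ σ) ⨾ σ ⨾ α ⨾ π₂ ⨾ σ       ≡⟨ _ ⟩⨾ σ ⟩⨾ pullˡ α⨾π₂ ⟩
      (id ⊗₁ σ) ⨾ σ ⨾ (π₂ ⊗₁ id) ⨾ σ   ≡⟨ _ ⟩⨾ σ ⟩⨾ σ-nat ⟩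
      (id ⊗₁ σ) ⨾ σ ⨾ σ ⨾ (id ⊗₁ π₂)   ≡⟨ _ ⟩⨾ cancelˡ σ-invol ⟩
      (id ⊗₁ σ) ⨾ (id ⊗₁ π₂)           ≡⟨ trans id⊗-fuse (cong (id ⊗₁_) σ⨾π₂) ⟩
      id ⊗₁ π₁                         ≡⟨ sym α⁻¹⨾π₁ ⟩
      α⁻¹ ⨾ π₁                         ∎
    second = begin
      ((id ⊗₁ σ) ⨾ σ ⨾ α ⨾ σ ⨾ (σ ⊗₁ id)) ⨾ π₂
        ≡⟨ trans assoc (_ ⟩⨾ trans assoc (σ ⟩⨾ trans assoc (α ⟩⨾ trans assoc
             (σ ⟩⨾ trans (π₂-natural (ladj⇒total ladj-σ)) idʳ)))) ⟩
      (id ⊗₁ σ) ⨾ σ ⨾ α ⨾ σ ⨾ π₂       ≡⟨ _ ⟩⨾ σ ⟩⨾ α ⟩⨾ σ⨾π₂ ⟩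
      (id ⊗₁ σ) ⨾ σ ⨾ α ⨾ π₁           ≡⟨ _ ⟩⨾ σ ⟩⨾ α⨾π₁ ⟩
      (id ⊗₁ σ) ⨾ σ ⨾ π₁ ⨾ π₁          ≡⟨ _ ⟩⨾ pullˡ σ⨾π₁ ⟩
      (id ⊗₁ σ) ⨾ π₂ ⨾ π₁              ≡⟨ pullˡ (π₂-natural idˡ) ⟩
      (π₂ ⨾ σ) ⨾ π₁                    ≡⟨ trans assoc (π₂ ⟩⨾ σ⨾π₁) ⟩
      π₂ ⨾ π₂                          ≡⟨ sym α⁻¹⨾π₂ ⟩
      α⁻¹ ⨾ π₂                         ∎

  ∧-glb : ∀ {X} {A B C : Pred X} → A ≤ B → A ≤ C → A ≤ B ∧ C
  ∧-glb {X} {A} {B} {C} p q =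
    A                        ≈⟨ sym (trans (A ⟩⨾ trans (cong (_⨾ lam) d-I) lam-iso₂) idʳ) ⟩
    A ⨾ d I ⨾ lam            ≈⟨ trans (sym assoc) (cong ((A ⨾ d I) ⨾_) (sym rho≡lam)) ⟩
    (A ⨾ d I) ⨾ rho          ≤⟨ ⨾-monoˡ (d-lax A) ⟩
    (d X ⨾ (A ⊗₁ A)) ⨾ rho   ≈⟨ assoc ⟩
    d X ⨾ (A ⊗₁ A) ⨾ rho     ≤⟨ ⨾-monoʳ (⨾-monoˡ (⊗-mono p q)) ⟩
    B ∧ C                    □

  ∧-mono : ∀ {X} {A A′ B B′ : Pred X} → A ≤ A′ → B ≤ B′ → A ∧ B ≤ A′ ∧ B′
  ∧-mono p q = ⨾-monoʳ (⨾-monoˡ (⊗-mono p q))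

  ∧-identityʳ : ∀ {X} {A : Pred X} → A ∧ e X ≡ A
  ∧-identityʳ = counitʳ-⊗

  ∧-identityˡ : ∀ {X} {A : Pred X} → e X ∧ A ≡ A
  ∧-identityˡ {X} = trans (d X ⟩⨾ _ ⟩⨾ rho≡lam) counitˡ-⊗

  reindex-∧ : ∀ {X Y} {k : X ⇒ Y} {A B : Pred Y} →
              k ⨾ d Y ≡ d X ⨾ (k ⊗₁ k) → k ⨾ (A ∧ B) ≡ (k ⨾ A) ∧ (k ⨾ B)
  reindex-∧ {X} p = trans (pullˡ p) (trans assoc (d X ⟩⨾ pullˡ ⊗-fuse))

  σ⨾d* : ∀ {X} → σ ⨾ d* X ≡ d* X
  σ⨾d* {X} = sym (rightAdjoint-unique d-unit d-counit unit counit)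
    where
    unit : id ≤ d X ⨾ σ ⨾ d* X
    unit = id ≤⟨ d-unit ⟩ d X ⨾ d* X ≈⟨ sym (pullˡ cocomm) ⟩ d X ⨾ σ ⨾ d* X □
    counit : (σ ⨾ d* X) ⨾ d X ≤ id
    counit = (σ ⨾ d* X) ⨾ d X ≈⟨ trans assoc (σ ⟩⨾ d* X ⟩⨾ sym cocomm) ⟩ σ ⨾ d* X ⨾ d X ⨾ σ
      ≈⟨ σ ⟩⨾ sym assoc ⟩ σ ⨾ (d* X ⨾ d X) ⨾ σ ≤⟨ ⨾-monoʳ (⨾-monoˡ d-counit) ⟩ σ ⨾ id ⨾ σ
      ≈⟨ trans (σ ⟩⨾ idˡ) σ-invol ⟩ id □

  d*-I : d* I ≡ lam
  d*-I = rightAdjoint-unique d-unit d-counit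
    (≡⇒≤ (sym (trans (cong (_⨾ lam) d-I) lam-iso₂))) (≡⇒≤ (trans (lam ⟩⨾ d-I) lam-iso₁))

  d*≤π₁ : ∀ {X} → d* X ≤ π₁
  d*≤π₁ {X} = d* X ≈⟨ sym (trans (d* X ⟩⨾ counitʳ) idʳ) ⟩ d* X ⨾ d X ⨾ π₁ ≈⟨ sym assoc ⟩
    (d* X ⨾ d X) ⨾ π₁ ≤⟨ ⨾-monoˡ d-counit ⟩ id ⨾ π₁ ≈⟨ idˡ ⟩ π₁ □

  d*≤π₂ : ∀ {X} → d* X ≤ π₂
  d*≤π₂ {X} = d* X ≈⟨ sym (trans (d* X ⟩⨾ counitˡ) idʳ) ⟩ d* X ⨾ d X ⨾ π₂ ≈⟨ sym assoc ⟩
    (d* X ⨾ d X) ⨾ π₂ ≤⟨ ⨾-monoˡ d-counit ⟩ id ⨾ π₂ ≈⟨ idˡ ⟩ π₂ □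

  frobenius′ : ∀ {X} → (id ⊗₁ d X) ⨾ α⁻¹ ⨾ (d* X ⊗₁ id) ≡ d* X ⨾ d X
  frobenius′ {X} = begin
    (id ⊗₁ d X) ⨾ α⁻¹ ⨾ (d* X ⊗₁ id)
      ≡⟨ _ ⟩⨾ cong (_⨾ (d* X ⊗₁ id)) (sym α⁻¹-via-σ) ⟩
    (id ⊗₁ d X) ⨾ ((id ⊗₁ σ) ⨾ σ ⨾ α ⨾ σ ⨾ (σ ⊗₁ id)) ⨾ (d* X ⊗₁ id)
      ≡⟨ _ ⟩⨾ trans assoc (_ ⟩⨾ trans assoc (σ ⟩⨾ trans assoc (α ⟩⨾ trans assoc
           (σ ⟩⨾ trans ⊗id-fuse (cong (_⊗₁ id) σ⨾d*))))) ⟩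
    (id ⊗₁ d X) ⨾ (id ⊗₁ σ) ⨾ σ ⨾ α ⨾ σ ⨾ (d* X ⊗₁ id)
      ≡⟨ pullˡ (trans id⊗-fuse (cong (id ⊗₁_) cocomm)) ⟩
    (id ⊗₁ d X) ⨾ σ ⨾ α ⨾ σ ⨾ (d* X ⊗₁ id)
      ≡⟨ slideˡ σ-nat ⟩
    σ ⨾ (d X ⊗₁ id) ⨾ α ⨾ σ ⨾ (d* X ⊗₁ id)
      ≡⟨ σ ⟩⨾ _ ⟩⨾ α ⟩⨾ sym σ-nat ⟩
    σ ⨾ (d X ⊗₁ id) ⨾ α ⨾ (id ⊗₁ d* X) ⨾ σ
      ≡⟨ σ ⟩⨾ pull³ frobenius ⟩
    σ ⨾ (d* X ⨾ d X) ⨾ σ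
      ≡⟨ trans (σ ⟩⨾ assoc) (pullˡ σ⨾d*) ⟩
    d* X ⨾ d X ⨾ σ
      ≡⟨ d* X ⟩⨾ cocomm ⟩
    d* X ⨾ d X
      ∎

  d*-as-meet : ∀ {X} → d (X ⊗₀ X) ⨾ (π₁ ⊗₁ δ X) ⨾ rho ≡ d* X
  d*-as-meet {X} = begin
    d (X ⊗₀ X) ⨾ (π₁ ⊗₁ δ X) ⨾ rho
      ≡⟨ _ ⟩⨾ cong (_⨾ rho) ⊗-splitˡ ⟩
    d (X ⊗₀ X) ⨾ ((π₁ ⊗₁ id) ⨾ (id ⊗₁ δ X)) ⨾ rho
      ≡⟨ trans (_ ⟩⨾ assoc) (pullˡ d⨾π₁⊗id) ⟩
    ((d X ⊗₁ id) ⨾ α) ⨾ (id ⊗₁ (d* X ⨾ e X)) ⨾ rho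
      ≡⟨ trans assoc (_ ⟩⨾ α ⟩⨾ pushˡ (sym id⊗-fuse)) ⟩
    (d X ⊗₁ id) ⨾ α ⨾ (id ⊗₁ d* X) ⨾ (id ⊗₁ e X) ⨾ rho
      ≡⟨ pull³ frobenius ⟩
    (d* X ⨾ d X) ⨾ (id ⊗₁ e X) ⨾ rho
      ≡⟨ trans assoc (d* X ⟩⨾ counitʳ) ⟩
    d* X ⨾ id
      ≡⟨ idʳ ⟩
    d* X
      ∎

  -- Comprehensive diagonals

  Δ≡d : ∀ {A} → Δ A ≡ d A
  Δ≡d {A} = trans (d A ⟩⨾ ⊗-id) idʳ

  π₁≤d*-under-δ : ∀ {Z A} (k : Z ⇒ (A ⊗₀ A)) → IsMap k → e Z ≤ k ⨾ δ A → k ⨾ π₁ ≤ k ⨾ d* A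
  π₁≤d*-under-δ {Z} {A} k mk hk =
    k ⨾ π₁                                  ≈⟨ sym counitʳ-⊗ ⟩
    d Z ⨾ ((k ⨾ π₁) ⊗₁ e Z) ⨾ rho           ≤⟨ ⨾-monoʳ (⨾-monoˡ (⊗-monoʳ hk)) ⟩
    d Z ⨾ ((k ⨾ π₁) ⊗₁ (k ⨾ δ A)) ⨾ rho     ≈⟨ d Z ⟩⨾ pushˡ ⊗-comp ⟩
    d Z ⨾ (k ⊗₁ k) ⨾ (π₁ ⊗₁ δ A) ⨾ rho      ≈⟨ trans (pullˡ (sym (proj₁ mk))) assoc ⟩
    k ⨾ d _ ⨾ (π₁ ⊗₁ δ A) ⨾ rho             ≈⟨ k ⟩⨾ d*-as-meet ⟩
    k ⨾ d* A                                □

  equalised-by-δ : ∀ {Z A} (k : Z ⇒ (A ⊗₀ A)) → IsMap k → e Z ≤ k ⨾ δ A → k ⨾ π₁ ≡ k ⨾ π₂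
  equalised-by-δ {Z} {A} k mk hk = ≤-antisym π₁≤π₂ π₂≤π₁
    where
    π₁≤π₂ : k ⨾ π₁ ≤ k ⨾ π₂
    π₁≤π₂ = ≤-trans (π₁≤d*-under-δ k mk hk) (⨾-monoʳ d*≤π₂)
    hkσ : e Z ≤ (k ⨾ σ) ⨾ δ A
    hkσ = e Z ≤⟨ hk ⟩ k ⨾ δ A ≈⟨ sym (trans assoc (k ⟩⨾ pullˡ σ⨾d*)) ⟩ (k ⨾ σ) ⨾ δ A □
    π₂≤π₁ : k ⨾ π₂ ≤ k ⨾ π₁
    π₂≤π₁ =
      k ⨾ π₂             ≈⟨ sym (trans assoc (k ⟩⨾ σ⨾π₁)) ⟩
      (k ⨾ σ) ⨾ π₁       ≤⟨ π₁≤d*-under-δ (k ⨾ σ) (map-⨾ mk (ladj⇒map ladj-σ)) hkσ ⟩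
      (k ⨾ σ) ⨾ d* A     ≈⟨ trans assoc (k ⟩⨾ σ⨾d*) ⟩
      k ⨾ d* A           ≤⟨ ⨾-monoʳ d*≤π₁ ⟩
      k ⨾ π₁             □

  d-isComprehension : ∀ {A} → IsComprehension (δ A) (d A)
  d-isComprehension {A} = ladj⇒map ladj-d , top , factor
    where
    top : e A ≤ d A ⨾ δ A
    top = e A ≈⟨ sym idˡ ⟩ id ⨾ e A ≤⟨ ⨾-monoˡ d-unit ⟩ (d A ⨾ d* A) ⨾ e A ≈⟨ assoc ⟩ d A ⨾ δ A □
    factor : ∀ {Z} (k : Z ⇒ (A ⊗₀ A)) → IsMap k → e Z ≤ k ⨾ δ A →
             Σ[ k′ ∈ Z ⇒ A ] ((IsMap k′ × k ≡ k′ ⨾ d A) × (∀ k″ → IsMap k″ → k ≡ k″ ⨾ d A → k″ ≡ k′))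
    factor k mk hk = k ⨾ π₁ , (map-⨾ mk (ladj⇒map ladj-π₁) , factorisation) , unique
      where
      factorisation : k ≡ (k ⨾ π₁) ⨾ d A
      factorisation = map-ext mk (map-⨾ (map-⨾ mk (ladj⇒map ladj-π₁)) (ladj⇒map ladj-d))
        (sym (trans assoc (trans (_ ⟩⨾ counitʳ) idʳ)))
        (sym (trans assoc (trans (_ ⟩⨾ counitˡ) (trans idʳ (equalised-by-δ k mk hk)))))
      unique : ∀ k″ → IsMap k″ → k ≡ k″ ⨾ d A → k″ ≡ k ⨾ π₁
      unique k″ _ p = sym (trans (cong (_⨾ π₁) p) (trans assoc (trans (k″ ⟩⨾ counitʳ) idʳ)))

  hasComprehensiveDiagonals : HasComprehensiveDiagonals
  hasComprehensiveDiagonals A = subst (IsComprehension (δ A)) (sym Δ≡d) d-isComprehension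

  -- 1-cells X ⇒ W as predicates on X ⊗ W

  π₁* : ∀ {X W} → X ⇒ (X ⊗₀ W)
  π₁* {X} {W} = rho⁻¹ ⨾ (id ⊗₁ e* W)

  π₁*⨾π₁≤id : ∀ {X W} → π₁* {X} {W} ⨾ π₁ ≤ id
  π₁*⨾π₁≤id {X} {W} =
    (rho⁻¹ ⨾ (id ⊗₁ e* W)) ⨾ (id ⊗₁ e W) ⨾ rho  ≈⟨ trans assoc (rho⁻¹ ⟩⨾ pullˡ id⊗-fuse) ⟩
    rho⁻¹ ⨾ (id ⊗₁ (e* W ⨾ e W)) ⨾ rho         ≤⟨ ⨾-monoʳ (⨾-monoˡ (⊗-monoʳ e-counit)) ⟩
    rho⁻¹ ⨾ (id ⊗₁ id) ⨾ rho                   ≈⟨ trans (rho⁻¹ ⟩⨾ trans (cong (_⨾ rho) ⊗-id) idˡ) rho-iso₂ ⟩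
    id                                         □

  d≤π₁* : ∀ {X} → d X ≤ π₁*
  d≤π₁* {X} =
    d X                                           ≈⟨ sym (trans (d X ⟩⨾ ⊗-id) idʳ) ⟩
    d X ⨾ (id ⊗₁ id)                              ≤⟨ ⨾-monoʳ (⊗-monoʳ e-unit) ⟩
    d X ⨾ (id ⊗₁ (e X ⨾ e* X))                    ≈⟨ d X ⟩⨾ sym id⊗-fuse ⟩
    d X ⨾ (id ⊗₁ e X) ⨾ (id ⊗₁ e* X)              ≈⟨ d X ⟩⨾ _ ⟩⨾ sym (cancelˡ rho-iso₁) ⟩
    d X ⨾ (id ⊗₁ e X) ⨾ rho ⨾ rho⁻¹ ⨾ (id ⊗₁ e* X) ≈⟨ pull³ counitʳ ⟩
    id ⨾ π₁*                                      ≈⟨ idˡ ⟩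
    π₁*                                           □

  π₁*⨾d* : ∀ {X} → π₁* ⨾ d* X ≡ id
  π₁*⨾d* {X} = ≤-antisym
    (π₁* ⨾ d* X ≤⟨ ⨾-monoʳ d*≤π₁ ⟩ π₁* ⨾ π₁ ≤⟨ π₁*⨾π₁≤id ⟩ id □)
    (id ≤⟨ d-unit ⟩ d X ⨾ d* X ≤⟨ ⨾-monoˡ d≤π₁* ⟩ π₁* ⨾ d* X □)

  -- c ∣ A restricts c to the part of its domain where A holds.
  _∣_ : ∀ {V C} → V ⇒ C → Pred V → V ⇒ C
  _∣_ {V} c A = d V ⨾ (A ⊗₁ c) ⨾ lam

  ∣-⨾ : ∀ {V C D} {c : V ⇒ C} {A : Pred V} {k : C ⇒ D} → (c ∣ A) ⨾ k ≡ (c ⨾ k) ∣ A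
  ∣-⨾ {V} {c = c} {A} {k} = begin
    (d V ⨾ (A ⊗₁ c) ⨾ lam) ⨾ k      ≡⟨ trans assoc (d V ⟩⨾ trans assoc (_ ⟩⨾ sym lam-nat)) ⟩
    d V ⨾ (A ⊗₁ c) ⨾ (id ⊗₁ k) ⨾ lam ≡⟨ d V ⟩⨾ pullˡ (trans ⊗-fuse (cong (_⊗₁ (c ⨾ k)) idʳ)) ⟩
    d V ⨾ (A ⊗₁ (c ⨾ k)) ⨾ lam       ∎

  graph : ∀ {X W} → X ⇒ W → Pred (X ⊗₀ W)
  graph {W = W} g = (g ⊗₁ id) ⨾ δ W

  fromGraph : ∀ {X W} → Pred (X ⊗₀ W) → X ⇒ W
  fromGraph P = π₁* ⨾ (π₂ ∣ P)

  fromGraph-mono : ∀ {X W} {P P′ : Pred (X ⊗₀ W)} → P ≤ P′ → fromGraph P ≤ fromGraph P′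
  fromGraph-mono p = ⨾-monoʳ (⨾-monoʳ (⨾-monoˡ (⊗-monoˡ p)))

  π₂-∣-graph : ∀ {X Y W} {g : X ⇒ Y} {k : Y ⇒ W} → (π₂ ⨾ k) ∣ graph g ≡ (g ⊗₁ id) ⨾ d* Y ⨾ k
  π₂-∣-graph {X} {Y} {W} {g} {k} = begin
    d (X ⊗₀ Y) ⨾ (graph g ⊗₁ (π₂ ⨾ k)) ⨾ lam
      ≡⟨ _ ⟩⨾ cong (_⨾ lam) (trans (cong (_⊗₁ (π₂ ⨾ k)) (sym idˡ)) ⊗-comp) ⟩
    d (X ⊗₀ Y) ⨾ ((id ⊗₁ π₂) ⨾ (graph g ⊗₁ k)) ⨾ lam
      ≡⟨ trans (_ ⟩⨾ assoc) (trans (pullˡ d⨾id⊗π₂) assoc) ⟩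
    (id ⊗₁ d Y) ⨾ α⁻¹ ⨾ (graph g ⊗₁ k) ⨾ lam
      ≡⟨ _ ⟩⨾ α⁻¹ ⟩⨾ cong (_⨾ lam) (trans (cong (graph g ⊗₁_) (sym idˡ)) ⊗-comp) ⟩
    (id ⊗₁ d Y) ⨾ α⁻¹ ⨾ (((g ⊗₁ id) ⊗₁ id) ⨾ (δ Y ⊗₁ k)) ⨾ lam
      ≡⟨ _ ⟩⨾ α⁻¹ ⟩⨾ assoc ⟩
    (id ⊗₁ d Y) ⨾ α⁻¹ ⨾ ((g ⊗₁ id) ⊗₁ id) ⨾ (δ Y ⊗₁ k) ⨾ lam
      ≡⟨ _ ⟩⨾ slideˡ (sym α⁻¹-nat) ⟩
    (id ⊗₁ d Y) ⨾ (g ⊗₁ (id ⊗₁ id)) ⨾ α⁻¹ ⨾ (δ Y ⊗₁ k) ⨾ lam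
      ≡⟨ slideˡ (trans ⊗-fuse (trans (cong₂ _⊗₁_ idˡ (trans (d Y ⟩⨾ ⊗-id) idʳ)) ⊗-splitˡ)) ⟩
    (g ⊗₁ id) ⨾ (id ⊗₁ d Y) ⨾ α⁻¹ ⨾ (δ Y ⊗₁ k) ⨾ lam
      ≡⟨ _ ⟩⨾ _ ⟩⨾ α⁻¹ ⟩⨾ cong (_⨾ lam) (trans (cong (δ Y ⊗₁_) (sym idˡ)) ⊗-comp) ⟩
    (g ⊗₁ id) ⨾ (id ⊗₁ d Y) ⨾ α⁻¹ ⨾ ((d* Y ⊗₁ id) ⨾ (e Y ⊗₁ k)) ⨾ lam
      ≡⟨ _ ⟩⨾ _ ⟩⨾ α⁻¹ ⟩⨾ assoc ⟩
    (g ⊗₁ id) ⨾ (id ⊗₁ d Y) ⨾ α⁻¹ ⨾ (d* Y ⊗₁ id) ⨾ (e Y ⊗₁ k) ⨾ lam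
      ≡⟨ _ ⟩⨾ pull³ frobenius′ ⟩
    (g ⊗₁ id) ⨾ (d* Y ⨾ d Y) ⨾ (e Y ⊗₁ k) ⨾ lam
      ≡⟨ _ ⟩⨾ trans assoc (d* Y ⟩⨾ counitˡ-⊗) ⟩
    (g ⊗₁ id) ⨾ d* Y ⨾ k
      ∎

  fromGraph-graph : ∀ {X W} {g : X ⇒ W} → fromGraph (graph g) ≡ g
  fromGraph-graph {X} {W} {g} = begin
    π₁* ⨾ (π₂ ∣ graph g)                           ≡⟨ π₁* ⟩⨾ cong (_∣ graph g) (sym idʳ) ⟩
    π₁* ⨾ ((π₂ ⨾ id) ∣ graph g)                    ≡⟨ π₁* ⟩⨾ π₂-∣-graph ⟩
    (rho⁻¹ ⨾ (id ⊗₁ e* W)) ⨾ (g ⊗₁ id) ⨾ d* W ⨾ id ≡⟨ trans assoc (rho⁻¹ ⟩⨾ slideˡ (sym (trans (sym ⊗-splitˡ) ⊗-splitʳ))) ⟩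
    rho⁻¹ ⨾ (g ⊗₁ id) ⨾ (id ⊗₁ e* W) ⨾ d* W ⨾ id   ≡⟨ slideˡ (sym rho⁻¹-nat) ⟩
    g ⨾ rho⁻¹ ⨾ (id ⊗₁ e* W) ⨾ d* W ⨾ id           ≡⟨ g ⟩⨾ trans (pull³ (trans (sym assoc) π₁*⨾d*)) idˡ ⟩
    g ⨾ id                                         ≡⟨ idʳ ⟩
    g                                              ∎

  π₁-∧-restrict : ∀ {V W C} {A : Pred V} {c : V ⇒ C} {B : Pred (C ⊗₀ W)} →
                  (π₁ ⨾ A) ∧ ((c ⊗₁ id) ⨾ B) ≡ ((c ∣ A) ⊗₁ id) ⨾ B
  π₁-∧-restrict {V} {W} {C} {A} {c} {B} = begin
    d (V ⊗₀ W) ⨾ ((π₁ ⨾ A) ⊗₁ ((c ⊗₁ id) ⨾ B)) ⨾ rho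
      ≡⟨ _ ⟩⨾ cong (_⨾ rho) (trans (cong ((π₁ ⨾ A) ⊗₁_) (sym idˡ)) ⊗-comp) ⟩
    d (V ⊗₀ W) ⨾ ((π₁ ⊗₁ id) ⨾ (A ⊗₁ ((c ⊗₁ id) ⨾ B))) ⨾ rho
      ≡⟨ trans (_ ⟩⨾ assoc) (trans (pullˡ d⨾π₁⊗id) assoc) ⟩
    (d V ⊗₁ id) ⨾ α ⨾ (A ⊗₁ ((c ⊗₁ id) ⨾ B)) ⨾ rho
      ≡⟨ _ ⟩⨾ α ⟩⨾ cong (_⨾ rho) (trans (cong (_⊗₁ ((c ⊗₁ id) ⨾ B)) (sym idʳ)) ⊗-comp) ⟩
    (d V ⊗₁ id) ⨾ α ⨾ ((A ⊗₁ (c ⊗₁ id)) ⨾ (id ⊗₁ B)) ⨾ rho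
      ≡⟨ _ ⟩⨾ α ⟩⨾ assoc ⟩
    (d V ⊗₁ id) ⨾ α ⨾ (A ⊗₁ (c ⊗₁ id)) ⨾ (id ⊗₁ B) ⨾ rho
      ≡⟨ _ ⟩⨾ slideˡ (sym α-nat) ⟩
    (d V ⊗₁ id) ⨾ ((A ⊗₁ c) ⊗₁ id) ⨾ α ⨾ (id ⊗₁ B) ⨾ rho
      ≡⟨ _ ⟩⨾ _ ⟩⨾ α ⟩⨾ trans (_ ⟩⨾ rho≡lam) lam-nat ⟩
    (d V ⊗₁ id) ⨾ ((A ⊗₁ c) ⊗₁ id) ⨾ α ⨾ lam ⨾ B
      ≡⟨ _ ⟩⨾ _ ⟩⨾ pullˡ (trans (α ⟩⨾ lam≡π₂) (trans α⨾π₂ (cong (_⊗₁ id) (sym lam≡π₂)))) ⟩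
    (d V ⊗₁ id) ⨾ ((A ⊗₁ c) ⊗₁ id) ⨾ (lam ⊗₁ id) ⨾ B
      ≡⟨ trans (_ ⟩⨾ pullˡ ⊗id-fuse) (pullˡ ⊗id-fuse) ⟩
    ((d V ⨾ (A ⊗₁ c) ⨾ lam) ⊗₁ id) ⨾ B
      ∎

  ∧-π₂-restrict : ∀ {X V C} {c : V ⇒ C} {A : Pred V} {B : Pred (X ⊗₀ C)} →
                  ((id ⊗₁ c) ⨾ B) ∧ (π₂ ⨾ A) ≡ (id ⊗₁ (d V ⨾ (c ⊗₁ A) ⨾ rho)) ⨾ B
  ∧-π₂-restrict {X} {V} {C} {c} {A} {B} = begin
    d (X ⊗₀ V) ⨾ (((id ⊗₁ c) ⨾ B) ⊗₁ (π₂ ⨾ A)) ⨾ rho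
      ≡⟨ _ ⟩⨾ cong (_⨾ rho) (trans (cong (_⊗₁ (π₂ ⨾ A)) (sym idˡ)) ⊗-comp) ⟩
    d (X ⊗₀ V) ⨾ ((id ⊗₁ π₂) ⨾ (((id ⊗₁ c) ⨾ B) ⊗₁ A)) ⨾ rho
      ≡⟨ trans (_ ⟩⨾ assoc) (trans (pullˡ d⨾id⊗π₂) assoc) ⟩
    (id ⊗₁ d V) ⨾ α⁻¹ ⨾ (((id ⊗₁ c) ⨾ B) ⊗₁ A) ⨾ rho
      ≡⟨ _ ⟩⨾ α⁻¹ ⟩⨾ cong (_⨾ rho) (trans (cong (((id ⊗₁ c) ⨾ B) ⊗₁_) (sym idʳ)) ⊗-comp) ⟩
    (id ⊗₁ d V) ⨾ α⁻¹ ⨾ (((id ⊗₁ c) ⊗₁ A) ⨾ (B ⊗₁ id)) ⨾ rho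
      ≡⟨ _ ⟩⨾ α⁻¹ ⟩⨾ trans assoc (_ ⟩⨾ rho-nat) ⟩
    (id ⊗₁ d V) ⨾ α⁻¹ ⨾ ((id ⊗₁ c) ⊗₁ A) ⨾ rho ⨾ B
      ≡⟨ _ ⟩⨾ slideˡ (sym α⁻¹-nat) ⟩
    (id ⊗₁ d V) ⨾ (id ⊗₁ (c ⊗₁ A)) ⨾ α⁻¹ ⨾ rho ⨾ B
      ≡⟨ _ ⟩⨾ _ ⟩⨾ pullˡ (trans (α⁻¹ ⟩⨾ rho≡π₁) (trans α⁻¹⨾π₁ (cong (id ⊗₁_) (sym rho≡π₁)))) ⟩
    (id ⊗₁ d V) ⨾ (id ⊗₁ (c ⊗₁ A)) ⨾ (id ⊗₁ rho) ⨾ B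
      ≡⟨ trans (_ ⟩⨾ pullˡ id⊗-fuse) (pullˡ id⊗-fuse) ⟩
    (id ⊗₁ (d V ⨾ (c ⊗₁ A) ⨾ rho)) ⨾ B
      ∎

  equalOnSecond : ∀ {X W} → Pred (X ⊗₀ W) → Pred ((X ⊗₀ W) ⊗₀ W)
  equalOnSecond {W = W} P = (π₁ ⨾ P) ∧ ((π₂ ⊗₁ id) ⨾ δ W)

  equalOnSecond≡ : ∀ {X W} {P : Pred (X ⊗₀ W)} → equalOnSecond P ≡ α ⨾ (id ⊗₁ d* W) ⨾ P
  equalOnSecond≡ {X} {W} {P} = begin
    equalOnSecond P
      ≡⟨ sym (cancelˡ α-iso₁) ⟩
    α ⨾ α⁻¹ ⨾ equalOnSecond P
      ≡⟨ α ⟩⨾ reindex-∧ (ladj⇒d-natural ladj-α⁻¹) ⟩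
    α ⨾ ((α⁻¹ ⨾ π₁ ⨾ P) ∧ (α⁻¹ ⨾ (π₂ ⊗₁ id) ⨾ δ W))
      ≡⟨ α ⟩⨾ cong₂ _∧_ (pullˡ α⁻¹⨾π₁) (pullˡ α⁻¹⨾π₂⊗id) ⟩
    α ⨾ (((id ⊗₁ π₁) ⨾ P) ∧ (π₂ ⨾ δ W))
      ≡⟨ α ⟩⨾ ∧-π₂-restrict ⟩
    α ⨾ (id ⊗₁ (d (W ⊗₀ W) ⨾ (π₁ ⊗₁ δ W) ⨾ rho)) ⨾ P
      ≡⟨ α ⟩⨾ cong (λ z → (id ⊗₁ z) ⨾ P) d*-as-meet ⟩
    α ⨾ (id ⊗₁ d* W) ⨾ P
      ∎

  graph-fromGraph-unfold : ∀ {X W} {P : Pred (X ⊗₀ W)} →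
                           graph (fromGraph P) ≡ (π₁* ⊗₁ id) ⨾ equalOnSecond P
  graph-fromGraph-unfold {X} {W} {P} = begin
    ((π₁* ⨾ (π₂ ∣ P)) ⊗₁ id) ⨾ δ W       ≡⟨ trans (cong (_⨾ δ W) (sym ⊗id-fuse)) assoc ⟩
    (π₁* ⊗₁ id) ⨾ ((π₂ ∣ P) ⊗₁ id) ⨾ δ W ≡⟨ _ ⟩⨾ sym π₁-∧-restrict ⟩
    (π₁* ⊗₁ id) ⨾ equalOnSecond P        ∎

  graph-fromGraph≤ : ∀ {X W} {P : Pred (X ⊗₀ W)} → graph (fromGraph P) ≤ P
  graph-fromGraph≤ {X} {W} {P} =
    graph (fromGraph P)                      ≈⟨ trans graph-fromGraph-unfold (_ ⟩⨾ equalOnSecond≡) ⟩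
    (π₁* ⊗₁ id) ⨾ α ⨾ (id ⊗₁ d* W) ⨾ P      ≤⟨ ⨾-monoʳ (⨾-monoʳ (⨾-monoˡ (⊗-monoʳ d*≤π₂))) ⟩
    (π₁* ⊗₁ id) ⨾ α ⨾ (id ⊗₁ π₂) ⨾ P        ≈⟨ _ ⟩⨾ pullˡ α⨾id⊗π₂ ⟩
    (π₁* ⊗₁ id) ⨾ (π₁ ⊗₁ id) ⨾ P            ≈⟨ pullˡ ⊗id-fuse ⟩
    ((π₁* ⨾ π₁) ⊗₁ id) ⨾ P                  ≤⟨ ⨾-monoˡ (⊗-monoˡ π₁*⨾π₁≤id) ⟩
    (id ⊗₁ id) ⨾ P                          ≈⟨ trans (cong (_⨾ P) ⊗-id) idˡ ⟩
    P                                       □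

  d≤π₂* : ∀ {W} → d W ≤ lam⁻¹ ⨾ (e* W ⊗₁ id)
  d≤π₂* {W} =
    d W                                             ≈⟨ sym (trans (d W ⟩⨾ ⊗-id) idʳ) ⟩
    d W ⨾ (id ⊗₁ id)                                ≤⟨ ⨾-monoʳ (⊗-monoˡ e-unit) ⟩
    d W ⨾ ((e W ⨾ e* W) ⊗₁ id)                      ≈⟨ d W ⟩⨾ sym ⊗id-fuse ⟩
    d W ⨾ (e W ⊗₁ id) ⨾ (e* W ⊗₁ id)                ≈⟨ d W ⟩⨾ _ ⟩⨾ sym (cancelˡ lam-iso₁) ⟩
    d W ⨾ (e W ⊗₁ id) ⨾ lam ⨾ lam⁻¹ ⨾ (e* W ⊗₁ id)  ≈⟨ trans (pull³ counitˡ) idˡ ⟩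
    lam⁻¹ ⨾ (e* W ⊗₁ id)                            □

  id⊗lam⁻¹⨾α⁻¹ : ∀ {X W} → (id ⊗₁ lam⁻¹) ⨾ α⁻¹ {X} {I} {W} ≡ rho⁻¹ ⊗₁ id
  id⊗lam⁻¹⨾α⁻¹ = map-ext (ladj⇒map (ladj-⨾ (ladj-⊗ ladj-id ladj-lam⁻¹) ladj-α⁻¹)) (ladj⇒map (ladj-⊗ ladj-rho⁻¹ ladj-id))
    (trans assoc (trans (_ ⟩⨾ α⁻¹⨾π₁) (trans id⊗-fuse
      (trans (cong (id ⊗₁_) (e-unique (ladj⇒total (ladj-⨾ ladj-lam⁻¹ ladj-π₁))))
      (sym (trans (π₁-natural idˡ) (trans assoc (trans (_ ⟩⨾ rho-iso₁) idʳ))))))))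
    (trans assoc (trans (_ ⟩⨾ α⁻¹⨾π₂) (trans (pullˡ (π₂-natural idˡ))
      (trans assoc (trans (_ ⟩⨾ trans (_ ⟩⨾ sym lam≡π₂) lam-iso₂)
      (trans idʳ (sym (trans (π₂-natural (ladj⇒total ladj-rho⁻¹)) idʳ))))))))

  id⊗d⨾α⁻¹≤π₁*⊗id : ∀ {X W} → (id ⊗₁ d W) ⨾ α⁻¹ ≤ π₁* {X} {W} ⊗₁ id
  id⊗d⨾α⁻¹≤π₁*⊗id {X} {W} =
    (id ⊗₁ d W) ⨾ α⁻¹                             ≤⟨ ⨾-monoˡ (⊗-monoʳ d≤π₂*) ⟩
    (id ⊗₁ (lam⁻¹ ⨾ (e* W ⊗₁ id))) ⨾ α⁻¹          ≈⟨ trans (cong (_⨾ α⁻¹) (sym id⊗-fuse)) assoc ⟩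
    (id ⊗₁ lam⁻¹) ⨾ (id ⊗₁ (e* W ⊗₁ id)) ⨾ α⁻¹    ≈⟨ _ ⟩⨾ α⁻¹-nat ⟩
    (id ⊗₁ lam⁻¹) ⨾ α⁻¹ ⨾ ((id ⊗₁ e* W) ⊗₁ id)    ≈⟨ pullˡ id⊗lam⁻¹⨾α⁻¹ ⟩
    (rho⁻¹ ⊗₁ id) ⨾ ((id ⊗₁ e* W) ⊗₁ id)          ≈⟨ ⊗id-fuse ⟩
    π₁* ⊗₁ id                                     □

  ≤graph-fromGraph : ∀ {X W} {P : Pred (X ⊗₀ W)} → P ≤ graph (fromGraph P)
  ≤graph-fromGraph {X} {W} {P} =
    P                                               ≈⟨ sym ∧-identityʳ ⟩
    P ∧ e _                                         ≤⟨ ∧-mono ≤-refl δ-holds ⟩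
    P ∧ (π₂ ⨾ d W ⨾ δ W)                            ≈⟨ sym (cong₂ _∧_ (trans (pullˡ s⨾π₁) idˡ) (trans (pullˡ s⨾π₂⊗id) assoc)) ⟩
    (s ⨾ π₁ ⨾ P) ∧ (s ⨾ (π₂ ⊗₁ id) ⨾ δ W)           ≈⟨ sym (reindex-∧ (ladj⇒d-natural ladj-s)) ⟩
    s ⨾ equalOnSecond P                             ≤⟨ ⨾-monoˡ id⊗d⨾α⁻¹≤π₁*⊗id ⟩
    (π₁* ⊗₁ id) ⨾ equalOnSecond P                   ≈⟨ sym graph-fromGraph-unfold ⟩
    graph (fromGraph P)                             □
    where
    s : (X ⊗₀ W) ⇒ ((X ⊗₀ W) ⊗₀ W)
    s = (id ⊗₁ d W) ⨾ α⁻¹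
    ladj-s : LeftAdjoint s
    ladj-s = ladj-⨾ (ladj-⊗ ladj-id ladj-d) ladj-α⁻¹
    s⨾π₁ : s ⨾ π₁ ≡ id
    s⨾π₁ = trans assoc (trans (_ ⟩⨾ α⁻¹⨾π₁) (trans id⊗-fuse (trans (cong (id ⊗₁_) counitʳ) ⊗-id)))
    s⨾π₂⊗id : s ⨾ (π₂ ⊗₁ id) ≡ π₂ ⨾ d W
    s⨾π₂⊗id = trans assoc (trans (_ ⟩⨾ α⁻¹⨾π₂⊗id) (π₂-natural idˡ))
    δ-holds : e _ ≤ π₂ ⨾ d W ⨾ δ W
    δ-holds = e _ ≈⟨ sym π₂-total ⟩ π₂ ⨾ e W ≤⟨ ⨾-monoʳ (≤-trans (≡⇒≤ (sym idˡ)) (⨾-monoˡ d-unit)) ⟩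
      π₂ ⨾ (d W ⨾ d* W) ⨾ e W ≈⟨ π₂ ⟩⨾ assoc ⟩ π₂ ⨾ d W ⨾ δ W □

  graph-fromGraph : ∀ {X W} {P : Pred (X ⊗₀ W)} → graph (fromGraph P) ≡ P
  graph-fromGraph = ≤-antisym graph-fromGraph≤ ≤graph-fromGraph

  δ-lax : ∀ {V W} {k : V ⇒ W} → IsMap k → δ V ≤ (k ⊗₁ k) ⨾ δ W
  δ-lax {V} {W} {k} (kd , ke) =
    d* V ⨾ e V                 ≈⟨ d* V ⟩⨾ sym ke ⟩
    d* V ⨾ k ⨾ e W             ≈⟨ sym assoc ⟩
    (d* V ⨾ k) ⨾ e W           ≤⟨ ⨾-monoˡ d*-lax ⟩
    ((k ⊗₁ k) ⨾ d* W) ⨾ e W    ≈⟨ assoc ⟩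
    (k ⊗₁ k) ⨾ δ W             □
    where
    d*-lax : d* V ⨾ k ≤ (k ⊗₁ k) ⨾ d* W
    d*-lax =
      d* V ⨾ k                         ≈⟨ sym (trans (sym assoc) idʳ) ⟩
      d* V ⨾ k ⨾ id                    ≤⟨ ⨾-monoʳ (⨾-monoʳ d-unit) ⟩
      d* V ⨾ k ⨾ d W ⨾ d* W            ≈⟨ d* V ⟩⨾ pullˡ kd ⟩
      d* V ⨾ (d V ⨾ (k ⊗₁ k)) ⨾ d* W   ≈⟨ trans (d* V ⟩⨾ assoc) (sym assoc) ⟩
      (d* V ⨾ d V) ⨾ (k ⊗₁ k) ⨾ d* W   ≤⟨ ⨾-monoˡ d-counit ⟩
      id ⨾ (k ⊗₁ k) ⨾ d* W             ≈⟨ idˡ ⟩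
      (k ⊗₁ k) ⨾ d* W                  □

  pair⨾π₁≤ : ∀ {X W₁ W₂} {g : X ⇒ W₁} {g′ : X ⇒ W₂} → (d X ⨾ (g ⊗₁ g′)) ⨾ π₁ ≤ g
  pair⨾π₁≤ {X} {g = g} {g′} =
    (d X ⨾ (g ⊗₁ g′)) ⨾ π₁        ≈⟨ trans assoc (d X ⟩⨾ pullˡ (trans ⊗-fuse (cong (_⊗₁ (g′ ⨾ e _)) idʳ))) ⟩
    d X ⨾ (g ⊗₁ (g′ ⨾ e _)) ⨾ rho  ≤⟨ ⨾-monoʳ (⨾-monoˡ (⊗-monoʳ (e-lax g′))) ⟩
    d X ⨾ (g ⊗₁ e X) ⨾ rho         ≈⟨ counitʳ-⊗ ⟩
    g                              □

  pair⨾π₂≤ : ∀ {X W₁ W₂} {g : X ⇒ W₁} {g′ : X ⇒ W₂} → (d X ⨾ (g ⊗₁ g′)) ⨾ π₂ ≤ g′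
  pair⨾π₂≤ {X} {g = g} {g′} =
    (d X ⨾ (g ⊗₁ g′)) ⨾ π₂        ≈⟨ trans assoc (d X ⟩⨾ pullˡ (trans ⊗-fuse (cong ((g ⨾ e _) ⊗₁_) idʳ))) ⟩
    d X ⨾ ((g ⨾ e _) ⊗₁ g′) ⨾ lam  ≤⟨ ⨾-monoʳ (⨾-monoˡ (⊗-monoˡ (e-lax g))) ⟩
    d X ⨾ (e X ⊗₁ g′) ⨾ lam        ≈⟨ counitˡ-⊗ ⟩
    g′                             □

  graph-pair≤ : ∀ {X W₁ W₂} {g : X ⇒ W₁} {g′ : X ⇒ W₂} →
                graph (d X ⨾ (g ⊗₁ g′)) ≤ ((id ⊗₁ π₁) ⨾ graph g) ∧ ((id ⊗₁ π₂) ⨾ graph g′)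
  graph-pair≤ {X} {W₁} {W₂} {g} {g′} = ∧-glb first second
    where
    k = d X ⨾ (g ⊗₁ g′)
    first : graph k ≤ (id ⊗₁ π₁) ⨾ graph g
    first =
      (k ⊗₁ id) ⨾ δ _                 ≤⟨ ⨾-monoʳ (δ-lax (ladj⇒map ladj-π₁)) ⟩
      (k ⊗₁ id) ⨾ (π₁ ⊗₁ π₁) ⨾ δ W₁   ≈⟨ pullˡ (trans ⊗-fuse (cong ((k ⨾ π₁) ⊗₁_) idˡ)) ⟩
      ((k ⨾ π₁) ⊗₁ π₁) ⨾ δ W₁         ≤⟨ ⨾-monoˡ (⊗-monoˡ pair⨾π₁≤) ⟩
      (g ⊗₁ π₁) ⨾ δ W₁                ≈⟨ trans (cong (_⨾ δ W₁) ⊗-splitʳ) assoc ⟩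
      (id ⊗₁ π₁) ⨾ graph g            □
    second : graph k ≤ (id ⊗₁ π₂) ⨾ graph g′
    second =
      (k ⊗₁ id) ⨾ δ _                 ≤⟨ ⨾-monoʳ (δ-lax (ladj⇒map ladj-π₂)) ⟩
      (k ⊗₁ id) ⨾ (π₂ ⊗₁ π₂) ⨾ δ W₂   ≈⟨ pullˡ (trans ⊗-fuse (cong ((k ⨾ π₂) ⊗₁_) idˡ)) ⟩
      ((k ⨾ π₂) ⊗₁ π₂) ⨾ δ W₂         ≤⟨ ⨾-monoˡ (⊗-monoˡ pair⨾π₂≤) ⟩
      (g′ ⊗₁ π₂) ⨾ δ W₂               ≈⟨ trans (cong (_⨾ δ W₂) ⊗-splitʳ) assoc ⟩
      (id ⊗₁ π₂) ⨾ graph g′           □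

  id≤π₁⨾π₁* : ∀ {X W} → id ≤ π₁ {X} {W} ⨾ π₁*
  id≤π₁⨾π₁* {X} {W} =
    id                                 ≈⟨ sym ⊗-id ⟩
    id ⊗₁ id                           ≤⟨ ⊗-monoʳ e-unit ⟩
    id ⊗₁ (e W ⨾ e* W)                 ≈⟨ sym id⊗-fuse ⟩
    (id ⊗₁ e W) ⨾ (id ⊗₁ e* W)         ≈⟨ _ ⟩⨾ sym (cancelˡ rho-iso₁) ⟩
    (id ⊗₁ e W) ⨾ rho ⨾ π₁*            ≈⟨ sym assoc ⟩
    π₁ ⨾ π₁*                           □

  rho⁻¹⨾π₁ : ∀ {X} → rho⁻¹ {X} ⨾ π₁ ≡ id
  rho⁻¹⨾π₁ = trans (rho⁻¹ ⟩⨾ sym rho≡π₁) rho-iso₂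

  fromGraph⨾e : ∀ {X Y} {R : Pred (X ⊗₀ Y)} → fromGraph R ⨾ e Y ≡ π₁* ⨾ R
  fromGraph⨾e {X} {Y} {R} = begin
    (π₁* ⨾ (π₂ ∣ R)) ⨾ e Y                     ≡⟨ trans assoc (π₁* ⟩⨾ ∣-⨾) ⟩
    π₁* ⨾ ((π₂ ⨾ e Y) ∣ R)                     ≡⟨ π₁* ⟩⨾ cong (_∣ R) π₂-total ⟩
    π₁* ⨾ (d (X ⊗₀ Y) ⨾ (R ⊗₁ e _) ⨾ lam)      ≡⟨ π₁* ⟩⨾ _ ⟩⨾ _ ⟩⨾ sym rho≡lam ⟩
    π₁* ⨾ (d (X ⊗₀ Y) ⨾ (R ⊗₁ e _) ⨾ rho)      ≡⟨ π₁* ⟩⨾ counitʳ-⊗ ⟩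
    π₁* ⨾ R                                    ∎

  fromGraph-total : ∀ {X Y} {R : Pred (X ⊗₀ Y)} → e X ≤ π₁* ⨾ R → Total (fromGraph R)
  fromGraph-total {R = R} total = ≤-antisym (e-lax (fromGraph R)) (≤-trans total (≡⇒≤ (sym fromGraph⨾e)))

  fromGraph-inGraph : ∀ {X Y} {R : Pred (X ⊗₀ Y)} → e X ≤ π₁* ⨾ R → e X ≤ ⟨ id , fromGraph R ⟩ ⨾ R
  fromGraph-inGraph {X} {Y} {R} total =
    e X                       ≤⟨ total ⟩
    π₁* ⨾ R                   ≤⟨ ⨾-monoʳ R≤R∣R⨾R ⟩
    π₁* ⨾ (id ∣ R) ⨾ R        ≈⟨ sym assoc ⟩
    K ⨾ R                     ≤⟨ ⨾-monoˡ K≤⟨id,f⟩ ⟩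
    ⟨ id , f ⟩ ⨾ R            □
    where
    f = fromGraph R
    K = π₁* ⨾ (id ∣ R)
    R≤R∣R⨾R : R ≤ (id ∣ R) ⨾ R
    R≤R∣R⨾R =
      R                         ≈⟨ sym (trans (R ⟩⨾ trans (cong (_⨾ lam) d-I) lam-iso₂) idʳ) ⟩
      R ⨾ d I ⨾ lam             ≈⟨ sym assoc ⟩
      (R ⨾ d I) ⨾ lam           ≤⟨ ⨾-monoˡ (d-lax R) ⟩
      (d _ ⨾ (R ⊗₁ R)) ⨾ lam    ≈⟨ trans assoc (d _ ⟩⨾ trans (cong (_⨾ lam) ⊗-splitˡ) (trans assoc (_ ⟩⨾ lam-nat))) ⟩
      d _ ⨾ (R ⊗₁ id) ⨾ lam ⨾ R ≈⟨ trans (d _ ⟩⨾ sym assoc) (sym assoc) ⟩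
      (id ∣ R) ⨾ R              □
    K⨾π₁≤id : K ⨾ π₁ ≤ id
    K⨾π₁≤id =
      K ⨾ π₁                     ≤⟨ ⨾-monoˡ (⨾-monoʳ (⨾-monoʳ (⨾-monoˡ (⊗-monoˡ (≤-e R))))) ⟩
      (π₁* ⨾ (id ∣ e _)) ⨾ π₁    ≈⟨ cong (λ z → (π₁* ⨾ z) ⨾ π₁) counitˡ ⟩
      (π₁* ⨾ id) ⨾ π₁            ≈⟨ cong (_⨾ π₁) idʳ ⟩
      π₁* ⨾ π₁                   ≤⟨ π₁*⨾π₁≤id ⟩
      id                         □
    K⨾π₂ : K ⨾ π₂ ≡ f
    K⨾π₂ = trans assoc (π₁* ⟩⨾ trans ∣-⨾ (cong (_∣ R) idˡ))
    K≤⟨id,f⟩ : K ≤ ⟨ id , f ⟩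
    K≤⟨id,f⟩ =
      K                             ≈⟨ sym (trans (K ⟩⨾ pairing-η) idʳ) ⟩
      K ⨾ d _ ⨾ (π₁ ⊗₁ π₂)          ≈⟨ sym assoc ⟩
      (K ⨾ d _) ⨾ (π₁ ⊗₁ π₂)        ≤⟨ ⨾-monoˡ (d-lax K) ⟩
      (d X ⨾ (K ⊗₁ K)) ⨾ (π₁ ⊗₁ π₂) ≈⟨ trans assoc (d X ⟩⨾ ⊗-fuse) ⟩
      d X ⨾ ((K ⨾ π₁) ⊗₁ (K ⨾ π₂))  ≤⟨ ⨾-monoʳ (⊗-mono K⨾π₁≤id (≡⇒≤ K⨾π₂)) ⟩
      ⟨ id , f ⟩                    □

  graph-reflects-≤ : ∀ {X Y} {g g′ : X ⇒ Y} → graph g ≤ graph g′ → g ≤ g′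
  graph-reflects-≤ {g = g} {g′} p =
    g ≈⟨ sym fromGraph-graph ⟩ fromGraph (graph g) ≤⟨ fromGraph-mono p ⟩ fromGraph (graph g′) ≈⟨ fromGraph-graph ⟩ g′ □

  -- Unique choice

  ⟨p₁,p₃⟩≡ : ∀ {X Y Z} → ⟨ p₁ , p₃ ⟩ ≡ π₁ {X} {Y} ⊗₁ id {Z}
  ⟨p₁,p₃⟩≡ = trans (cong (λ z → d _ ⨾ ((π₁ ⨾ π₁) ⊗₁ z)) (sym idʳ)) pairing-π

  ⟨p₁,p₂⟩≡ : ∀ {X Y Z} → ⟨ p₁ , p₂ ⟩ ≡ π₁ {X ⊗₀ Y} {Z}
  ⟨p₁,p₂⟩≡ = trans (_ ⟩⨾ ⊗-comp)
    (trans (pullˡ (sym (ladj⇒d-natural ladj-π₁))) (trans assoc (trans (π₁ ⟩⨾ pairing-η) idʳ)))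

  ⟨p₂,p₃⟩≡ : ∀ {X Y Z} → ⟨ p₂ , p₃ ⟩ ≡ π₂ {X} {Y} ⊗₁ id {Z}
  ⟨p₂,p₃⟩≡ = trans (cong (λ z → d _ ⨾ ((π₁ ⨾ π₂) ⊗₁ z)) (sym idʳ)) pairing-π

  eᴬ≡e : ∀ {X} → (e X ⊗₁ id) ⨾ δ I ≡ e (X ⊗₀ I)
  eᴬ≡e {X} = begin
    (e X ⊗₁ id) ⨾ d* I ⨾ e I    ≡⟨ _ ⟩⨾ cong₂ _⨾_ d*-I e-I ⟩
    (e X ⊗₁ id) ⨾ lam ⨾ id      ≡⟨ _ ⟩⨾ idʳ ⟩
    (e X ⊗₁ id) ⨾ lam           ≡⟨ e-unique (ladj⇒total (ladj-⨾ (ladj-⊗ ladj-e ladj-id) ladj-lam)) ⟩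
    e (X ⊗₀ I)                  ∎

  module UniqueChoice (E : Exists₁₃) where
    open Exists₁₃ E
    open AP E

    ∃₁₃-upper : ∀ {X Y Z} (U : Pred ((X ⊗₀ Y) ⊗₀ Z)) → ∃₁₃ U ≤ (π₁* ⊗₁ id) ⨾ U
    ∃₁₃-upper U = ∃₁₃-adj₂ U _
      (U                                        ≈⟨ sym idˡ ⟩
       id ⨾ U                                   ≈⟨ cong (_⨾ U) (sym ⊗-id) ⟩
       (id ⊗₁ id) ⨾ U                           ≤⟨ ⨾-monoˡ (⊗-monoˡ id≤π₁⨾π₁*) ⟩
       ((π₁ ⨾ π₁*) ⊗₁ id) ⨾ U                   ≈⟨ trans (cong (_⨾ U) (sym ⊗id-fuse)) assoc ⟩
       (π₁ ⊗₁ id) ⨾ (π₁* ⊗₁ id) ⨾ U             ≈⟨ cong (_⨾ ((π₁* ⊗₁ id) ⨾ U)) (sym ⟨p₁,p₃⟩≡) ⟩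
       ⟨ p₁ , p₃ ⟩ ⨾ (π₁* ⊗₁ id) ⨾ U            □)

    ∃₁₃-lower : ∀ {X Y Z} (U : Pred ((X ⊗₀ Y) ⊗₀ Z)) (s : (X ⊗₀ Z) ⇒ ((X ⊗₀ Y) ⊗₀ Z)) →
                s ⨾ ⟨ p₁ , p₃ ⟩ ≡ id → s ⨾ U ≤ ∃₁₃ U
    ∃₁₃-lower U s section =
      s ⨾ U                        ≤⟨ ⨾-monoʳ (∃₁₃-adj₁ U (∃₁₃ U) ≤-refl) ⟩
      s ⨾ ⟨ p₁ , p₃ ⟩ ⨾ ∃₁₃ U      ≈⟨ cancelˡ section ⟩
      ∃₁₃ U                        □

    relation-total : ∀ {X Y} {R : Rel X Y} → R ⨾ᴬ eᴬ Y ≡ eᴬ X → e X ≤ π₁* ⨾ R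
    relation-total {X} {Y} {R} total =
      e X                                                      ≈⟨ sym (ladj⇒total ladj-rho⁻¹) ⟩
      rho⁻¹ ⨾ e (X ⊗₀ I)                                       ≈⟨ rho⁻¹ ⟩⨾ trans (sym eᴬ≡e) (sym total) ⟩
      rho⁻¹ ⨾ (R ⨾ᴬ eᴬ Y)                                      ≤⟨ ⨾-monoʳ (∃₁₃-upper _) ⟩
      rho⁻¹ ⨾ (π₁* ⊗₁ id) ⨾ ((⟨ p₁ , p₂ ⟩ ⨾ R) ∧ (⟨ p₂ , p₃ ⟩ ⨾ eᴬ Y)) ≈⟨ rho⁻¹ ⟩⨾ _ ⟩⨾ forget-eᴬ ⟩
      rho⁻¹ ⨾ (π₁* ⊗₁ id) ⨾ π₁ ⨾ R                             ≈⟨ rho⁻¹ ⟩⨾ pullˡ (π₁-natural idˡ) ⟩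
      rho⁻¹ ⨾ (π₁ ⨾ π₁*) ⨾ R                                   ≈⟨ trans (rho⁻¹ ⟩⨾ assoc) (cancelˡ rho⁻¹⨾π₁) ⟩
      π₁* ⨾ R                                                  □
      where
      forget-eᴬ : (⟨ p₁ , p₂ ⟩ ⨾ R) ∧ (⟨ p₂ , p₃ ⟩ ⨾ eᴬ Y) ≡ π₁ ⨾ R
      forget-eᴬ = trans (cong₂ _∧_ (cong (_⨾ R) ⟨p₁,p₂⟩≡)
        (trans (cong₂ _⨾_ ⟨p₂,p₃⟩≡ eᴬ≡e) (ladj⇒total (ladj-⊗ ladj-π₂ ladj-id)))) ∧-identityʳ

    ⨾ᴬdᴬ≤graph : ∀ {X Y} {R : Rel X Y} → R ⨾ᴬ dᴬ Y ≤ graph (fromGraph R ⨾ d Y)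
    ⨾ᴬdᴬ≤graph {X} {Y} {R} = ∃₁₃-adj₂ _ _
      ((⟨ p₁ , p₂ ⟩ ⨾ R) ∧ (⟨ p₂ , p₃ ⟩ ⨾ dᴬ Y)
         ≈⟨ cong₂ _∧_ (cong (_⨾ R) ⟨p₁,p₂⟩≡) (trans (cong (_⨾ dᴬ Y) ⟨p₂,p₃⟩≡)
              (pullˡ (trans ⊗id-fuse (cong (_⊗₁ id) (π₂ ⟩⨾ Δ≡d))))) ⟩
       (π₁ ⨾ R) ∧ (((π₂ ⨾ d Y) ⊗₁ id) ⨾ δ _)        ≈⟨ cong (λ P → (π₁ ⨾ P) ∧ _) (sym graph-fromGraph) ⟩
       (π₁ ⨾ graph f) ∧ (((π₂ ⨾ d Y) ⊗₁ id) ⨾ δ _)  ≈⟨ π₁-∧-restrict ⟩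
       (((π₂ ⨾ d Y) ∣ graph f) ⊗₁ id) ⨾ δ _        ≈⟨ cong (λ z → (z ⊗₁ id) ⨾ δ _) π₂-∣-graph ⟩
       (((f ⊗₁ id) ⨾ d* Y ⨾ d Y) ⊗₁ id) ⨾ δ _     ≤⟨ ⨾-monoˡ (⊗-monoˡ (⨾-monoʳ (⨾-monoˡ d*≤π₁))) ⟩
       (((f ⊗₁ id) ⨾ π₁ ⨾ d Y) ⊗₁ id) ⨾ δ _       ≈⟨ cong (λ z → (z ⊗₁ id) ⨾ δ _) (trans (pullˡ (π₁-natural idˡ)) assoc) ⟩
       ((π₁ ⨾ f ⨾ d Y) ⊗₁ id) ⨾ δ _               ≈⟨ trans (cong (_⨾ δ _) (sym ⊗id-fuse)) assoc ⟩
       (π₁ ⊗₁ id) ⨾ graph (f ⨾ d Y)               ≈⟨ cong (_⨾ graph (f ⨾ d Y)) (sym ⟨p₁,p₃⟩≡) ⟩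
       ⟨ p₁ , p₃ ⟩ ⨾ graph (f ⨾ d Y)              □)
      where
      f = fromGraph R

    both-related≤dᴬ⨾ᴬ⊗ᴬ : ∀ {X Y} {R : Rel X Y} →
                          ((id ⊗₁ π₁) ⨾ R) ∧ ((id ⊗₁ π₂) ⨾ R) ≤ dᴬ X ⨾ᴬ (R ⊗ᴬ R)
    both-related≤dᴬ⨾ᴬ⊗ᴬ {X} {Y} {R} =
      ((id ⊗₁ π₁) ⨾ R) ∧ ((id ⊗₁ π₂) ⨾ R)                           ≈⟨ sym ∧-identityˡ ⟩
      e _ ∧ _                                                       ≤⟨ ∧-mono diagonal-holds (≡⇒≤ (sym tensor-holds)) ⟩
      (s ⨾ ⟨ p₁ , p₂ ⟩ ⨾ dᴬ X) ∧ (s ⨾ ⟨ p₂ , p₃ ⟩ ⨾ (R ⊗ᴬ R))       ≈⟨ sym (reindex-∧ (ladj⇒d-natural ladj-s)) ⟩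
      s ⨾ ((⟨ p₁ , p₂ ⟩ ⨾ dᴬ X) ∧ (⟨ p₂ , p₃ ⟩ ⨾ (R ⊗ᴬ R)))          ≤⟨ ∃₁₃-lower _ s s⨾⟨p₁,p₃⟩ ⟩
      dᴬ X ⨾ᴬ (R ⊗ᴬ R)                                              □
      where
      s : (X ⊗₀ (Y ⊗₀ Y)) ⇒ ((X ⊗₀ (X ⊗₀ X)) ⊗₀ (Y ⊗₀ Y))
      s = (d X ⨾ (id ⊗₁ d X)) ⊗₁ id
      ladj-s : LeftAdjoint s
      ladj-s = ladj-⊗ (ladj-⨾ ladj-d (ladj-⊗ ladj-id ladj-d)) ladj-id
      s⨾⟨p₁,p₃⟩ : s ⨾ ⟨ p₁ , p₃ ⟩ ≡ id
      s⨾⟨p₁,p₃⟩ = trans (s ⟩⨾ ⟨p₁,p₃⟩≡) (trans ⊗-fuse (trans (cong₂ _⊗₁_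
        (trans assoc (trans (d X ⟩⨾ trans (π₁-natural (ladj⇒total ladj-d)) idʳ) counitʳ)) idˡ) ⊗-id))
      s⨾π₂⊗id : s ⨾ (π₂ ⊗₁ id) ≡ d X ⊗₁ id
      s⨾π₂⊗id = trans ⊗-fuse (cong₂ _⊗₁_ (trans assoc (trans (d X ⟩⨾ π₂-natural idˡ) (cancelˡ counitˡ))) idˡ)
      diagonal-holds : e _ ≤ s ⨾ ⟨ p₁ , p₂ ⟩ ⨾ dᴬ X
      diagonal-holds =
        e _                                          ≈⟨ sym (ladj⇒total (ladj-⨾ ladj-π₁ ladj-d)) ⟩
        (π₁ ⨾ d X) ⨾ e (X ⊗₀ X)                      ≤⟨ ⨾-monoʳ (≤-trans (≡⇒≤ (sym idˡ)) (⨾-monoˡ d-unit)) ⟩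
        (π₁ ⨾ d X) ⨾ (d (X ⊗₀ X) ⨾ d* _) ⨾ e _        ≈⟨ sym unfold ⟩
        s ⨾ ⟨ p₁ , p₂ ⟩ ⨾ dᴬ X                       □
        where
        unfold : s ⨾ ⟨ p₁ , p₂ ⟩ ⨾ dᴬ X ≡ (π₁ ⨾ d X) ⨾ (d (X ⊗₀ X) ⨾ d* _) ⨾ e _
        unfold = begin
          s ⨾ ⟨ p₁ , p₂ ⟩ ⨾ (Δ X ⊗₁ id) ⨾ δ _
            ≡⟨ trans (s ⟩⨾ cong (_⨾ ((Δ X ⊗₁ id) ⨾ δ _)) ⟨p₁,p₂⟩≡) (pullˡ (π₁-natural idˡ)) ⟩
          (π₁ ⨾ d X ⨾ (id ⊗₁ d X)) ⨾ (Δ X ⊗₁ id) ⨾ δ _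
            ≡⟨ trans assoc (π₁ ⟩⨾ trans assoc (d X ⟩⨾ pullˡ (trans ⊗-fuse (cong₂ _⊗₁_ (trans idˡ Δ≡d) idʳ)))) ⟩
          π₁ ⨾ d X ⨾ (d X ⊗₁ d X) ⨾ δ _
            ≡⟨ π₁ ⟩⨾ pullˡ (sym (ladj⇒d-natural ladj-d)) ⟩
          π₁ ⨾ (d X ⨾ d (X ⊗₀ X)) ⨾ δ _
            ≡⟨ trans (π₁ ⟩⨾ trans assoc (d X ⟩⨾ sym assoc)) (sym assoc) ⟩
          (π₁ ⨾ d X) ⨾ (d (X ⊗₀ X) ⨾ d* _) ⨾ e _
            ∎
      tensor-holds : s ⨾ ⟨ p₂ , p₃ ⟩ ⨾ (R ⊗ᴬ R) ≡ ((id ⊗₁ π₁) ⨾ R) ∧ ((id ⊗₁ π₂) ⨾ R)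
      tensor-holds = begin
        s ⨾ ⟨ p₂ , p₃ ⟩ ⨾ (R ⊗ᴬ R)
          ≡⟨ trans (s ⟩⨾ cong (_⨾ (R ⊗ᴬ R)) ⟨p₂,p₃⟩≡) (pullˡ s⨾π₂⊗id) ⟩
        (d X ⊗₁ id) ⨾ (R ⊗ᴬ R)
          ≡⟨ reindex-∧ (ladj⇒d-natural (ladj-⊗ ladj-d ladj-id)) ⟩
        ((d X ⊗₁ id) ⨾ ⟨ π₁ ⨾ π₁ , π₂ ⨾ π₁ ⟩ ⨾ R) ∧ ((d X ⊗₁ id) ⨾ ⟨ π₁ ⨾ π₂ , π₂ ⨾ π₂ ⟩ ⨾ R)
          ≡⟨ cong₂ _∧_ (pullˡ (trans (_ ⟩⨾ pairing-π) (trans ⊗-fuse (cong₂ _⊗₁_ counitʳ idˡ))))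
                       (pullˡ (trans (_ ⟩⨾ pairing-π) (trans ⊗-fuse (cong₂ _⊗₁_ counitˡ idˡ)))) ⟩
        ((id ⊗₁ π₁) ⨾ R) ∧ ((id ⊗₁ π₂) ⨾ R)
          ∎

    fromGraph-single-valued : ∀ {X Y} {R : Rel X Y} → R ⨾ᴬ dᴬ Y ≡ dᴬ X ⨾ᴬ (R ⊗ᴬ R) →
                              d X ⨾ (fromGraph R ⊗₁ fromGraph R) ≤ fromGraph R ⨾ d Y
    fromGraph-single-valued {X} {Y} {R} functional = graph-reflects-≤
      (graph (d X ⨾ (f ⊗₁ f))                              ≤⟨ graph-pair≤ ⟩
       ((id ⊗₁ π₁) ⨾ graph f) ∧ ((id ⊗₁ π₂) ⨾ graph f)     ≈⟨ cong₂ (λ P Q → ((id ⊗₁ π₁) ⨾ P) ∧ ((id ⊗₁ π₂) ⨾ Q)) graph-fromGraph graph-fromGraph ⟩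
       ((id ⊗₁ π₁) ⨾ R) ∧ ((id ⊗₁ π₂) ⨾ R)                 ≤⟨ both-related≤dᴬ⨾ᴬ⊗ᴬ ⟩
       dᴬ X ⨾ᴬ (R ⊗ᴬ R)                                    ≈⟨ sym functional ⟩
       R ⨾ᴬ dᴬ Y                                           ≤⟨ ⨾ᴬdᴬ≤graph ⟩
       graph (f ⨾ d Y)                                     □)
      where
      f = fromGraph R

    ruleOfUniqueChoice : RuleOfUniqueChoice E
    ruleOfUniqueChoice R (functional , total) =
      fromGraph R ,
      (≤-antisym (d-lax (fromGraph R)) (fromGraph-single-valued functional) ,
       fromGraph-total (relation-total total)) ,
      fromGraph-inGraph (relation-total total)

proposition8p5 : ∀ {o h ℓ} (B : CartesianBicategory o h ℓ) →
    Notions.HasComprehensiveDiagonals B ×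
    ((E : Notions.Exists₁₃ B) → Notions.RuleOfUniqueChoice B E)
proposition8p5 B = hasComprehensiveDiagonals , UniqueChoice.ruleOfUniqueChoice
  where open Properties B
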